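{- If a graph $G$ is reducible to a graph $H$ and $H$ is simply bad, then $G$ is simply bad.
   Context: Graphs are finite and simple. $G$ is simply reducible to $H$ if $G$ has a cycle $C$ of odd length such that $H$ is obtained from $G$ by contracting $C$ to a single vertex. $G$ is reducible to $H$ if there are graphs $G_0=G, G_1,\ldots,G_k=H$ ($k\ge 0$ fixed) such that $G_{i-1}$ is simply reducible to $G_i$ for $1\le i\le k$. For a graph $G$ with a $1$-factor $F$: a cycle $C$ is $F$-alternating if $|E(C)|=2|E(F)\cap E(C)|$; in an orientation of $G$ an even cycle $C$ is evenly (resp. oddly) oriented if, for either direction of traversal, the number of edges of $C$ directed along the traversal is even (resp. odd); a zero-sum $F$-set is a finite family $\{C_1,\ldots,C_k\}$ of $F$-alternating cycles such that every edge of $G$ lies in an even number of its members, and it is an odd $F$-set if $k$ is odd. A graph $G$ is simply bad if it has a $1$-factor $F$ such that $G$ has an odd $F$-set $\mathcal{A}$ and an orientation in which every member of $\mathcal{A}$ is evenly oriented. -}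

module Defs where

open import Data.Nat using (ℕ; zero; suc; _+_; _*_; _≤_)
open import Data.Nat.Divisibility using (_∣_)
open import Data.Fin using (Fin; _≟_)
open import Data.Bool using (Bool; true; false; not; _∧_; _∨_; if_then_else_)
open import Data.List using (List; []; _∷_; _++_; [_]; length; reverse)
open import Data.List.Relation.Unary.All using (All)
open import Data.List.Relation.Unary.Unique.Propositional using (Unique)
open import Data.List.Membership.Propositional using (_∈_; _∉_)
open import Data.Product using (Σ; ∃; _×_; _,_; proj₁; proj₂)
open import Relation.Nullary using (¬_)
open import Relation.Nullary.Decidable using (⌊_⌋)
open import Relation.Binary.PropositionalEquality using (_≡_; _≢_)
open import Relation.Binary.Construct.Closure.ReflexiveTransitive using (Star)
open import Function.Bundles using (_⇔_)

record Graph : Set where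
  field
    n       : ℕ
    adj     : Fin n → Fin n → Bool
    adj-sym : ∀ u v → adj u v ≡ adj v u
    adj-irr : ∀ u → adj u u ≡ false

open Graph public

V : Graph → Set
V G = Fin (n G)

Edge : (G : Graph) → V G → V G → Set
Edge G u v = adj G u v ≡ true

countᵇ : {A : Set} → (A → Bool) → List A → ℕ
countᵇ p []       = 0
countᵇ p (x ∷ xs) = (if p x then 1 else 0) + countᵇ p xs

Even Odd : ℕ → Set
Even k = 2 ∣ k
Odd  k = ¬ (2 ∣ k)

consec : {A : Set} → A → List A → List (A × A)
consec a []       = []
consec a (b ∷ bs) = (a , b) ∷ consec b bs

cycEdges : {A : Set} → List A → List (A × A)
cycEdges []       = []
cycEdges (x ∷ xs) = consec x (xs ++ [ x ])

record Cycle (G : Graph) : Set where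
  field
    verts    : List (V G)
    len≥3    : 3 ≤ length verts
    distinct : Unique verts
    adjacent : All (λ e → Edge G (proj₁ e) (proj₂ e)) (cycEdges verts)

open Cycle public

-- |E(C)| = |V(C)|
cycLen : {G : Graph} → Cycle G → ℕ
cycLen C = length (verts C)

OddCycle : {G : Graph} → Cycle G → Set
OddCycle C = Odd (cycLen C)

sameEdge : {m : ℕ} → Fin m → Fin m → Fin m × Fin m → Bool
sameEdge u v (a , b) = (⌊ a ≟ u ⌋ ∧ ⌊ b ≟ v ⌋) ∨ (⌊ a ≟ v ⌋ ∧ ⌊ b ≟ u ⌋)

edgeOn : {G : Graph} → V G → V G → Cycle G → Bool
edgeOn u v C = 0 Data.Nat.<ᵇ countᵇ (sameEdge u v) (cycEdges (verts C))
  where import Data.Nat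

record OneFactor (G : Graph) : Set where
  field
    inF     : V G → V G → Bool
    inF-sym : ∀ u v → inF u v ≡ inF v u
    inF-E   : ∀ u v → inF u v ≡ true → Edge G u v
    perfect : ∀ u → Σ (V G) λ w → inF u w ≡ true × (∀ w' → inF u w' ≡ true → w' ≡ w)

open OneFactor public

FonC : {G : Graph} → OneFactor G → Cycle G → ℕ
FonC F C = countᵇ (λ e → inF F (proj₁ e) (proj₂ e)) (cycEdges (verts C))

FAlternating : {G : Graph} → OneFactor G → Cycle G → Set
FAlternating F C = cycLen C ≡ 2 * FonC F C

multiplicity : {G : Graph} → V G → V G → List (Cycle G) → ℕ
multiplicity u v = countᵇ (edgeOn u v)

ZeroSumFSet : {G : Graph} → OneFactor G → List (Cycle G) → Set
ZeroSumFSet {G} F 𝒜 =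
  All (FAlternating F) 𝒜 × (∀ u v → Edge G u v → Even (multiplicity u v 𝒜))

OddFSet : {G : Graph} → OneFactor G → List (Cycle G) → Set
OddFSet F 𝒜 = ZeroSumFSet F 𝒜 × Odd (length 𝒜)

-- Orientations: dir u v = true means the edge uv is directed from u to v;
-- every edge gets exactly one direction.

record Orientation (G : Graph) : Set where
  field
    dir       : V G → V G → Bool
    dir-edge  : ∀ u v → dir u v ≡ true → Edge G u v
    dir-exact : ∀ u v → Edge G u v → dir v u ≡ not (dir u v)

open Orientation public

forwardCount : {G : Graph} → Orientation G → List (V G × V G) → ℕ
forwardCount D = countᵇ (λ e → dir D (proj₁ e) (proj₂ e))

EvenlyOriented : {G : Graph} → Orientation G → Cycle G → Set
EvenlyOriented D C =
  Even (forwardCount D (cycEdges (verts C))) ×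
  Even (forwardCount D (cycEdges (reverse (verts C))))

SimplyBad : Graph → Set
SimplyBad G =
  Σ (OneFactor G) λ F →
  Σ (List (Cycle G)) λ 𝒜 →
  OddFSet F 𝒜 ×
  Σ (Orientation G) λ D → All (EvenlyOriented D) 𝒜

-- H is (isomorphic to) the graph obtained
-- from G by contracting C to a single vertex c: there is a surjection
-- φ : V(G) → V(H) sending V(C) to c, injective on V(G) ∖ V(C) and missing c
-- there, with xy ∈ E(H) iff x ≠ y and some edge uv of G has φu = x, φv = y.

SimplyReducible : Graph → Graph → Set
SimplyReducible G H =
  Σ (Cycle G) λ C → OddCycle C ×
  Σ (V G → V H) λ φ → Σ (V H) λ c →
    (∀ u → u ∈ verts C → φ u ≡ c) ×
    (∀ u → u ∉ verts C → φ u ≢ c) ×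
    (∀ u w → u ∉ verts C → w ∉ verts C → φ u ≡ φ w → u ≡ w) ×
    (∀ x → Σ (V G) λ u → φ u ≡ x) ×
    (∀ x y → Edge H x y ⇔
       (x ≢ y × Σ (V G) λ u → Σ (V G) λ w → φ u ≡ x × φ w ≡ y × Edge G u w))

Reducible : Graph → Graph → Set
Reducible = Star SimplyReducible

module Submission where

-- It suffices to undo a single contraction of an odd cycle C to a vertex c.
-- Let p be the partner of c in the 1-factor F′ of H and u₀ a vertex of C
-- adjacent to the preimage of p.  Away from C keep F′ and the orientation
-- of H; match u₀ with the preimage of p, match the even path C − u₀ by every
-- other edge, and orient C cyclically.  An F′-alternating cycle Z through c
-- uses the edge cp and one other edge cy; it lifts by replacing c with the
-- path inside C from the attachment of y to u₀ that starts with a matching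
-- edge.  That path is alternating and has an even number of forward edges, so
-- alternation and even orientation survive.  Which edges of C the lift uses
-- depends only on y, and the number of members with a given y is the
-- multiplicity of cy in the family, which is even; so the lifted family is
-- again an odd F-set.

open import Defs

open import Data.Bool using (Bool; true; false; not; _∧_; _∨_; if_then_else_; T)
open import Data.Bool.Properties using (∧-zeroʳ; ∧-identityʳ; ∨-identityʳ; ∨-idem; ∧-comm; ∨-comm; not-involutive)
open import Data.Empty using (⊥; ⊥-elim)
open import Data.Fin using (Fin; zero; suc) renaming (_≟_ to _≟F_)
open import Data.List using (List; []; _∷_; _++_; [_]; length; reverse; map; downFrom)
open import Data.List.Properties
  using (++-assoc; reverse-++; length-++; map-++; length-map; unfold-reverse; ++-identityʳ; length-downFrom)
open import Data.List.Membership.Propositional using (_∈_; _∉_)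
open import Data.List.Membership.Propositional.Properties using (∈-∃++; ∈-map⁻)
open import Data.List.Relation.Binary.Permutation.Propositional as ↭
  using (_↭_; prep; swap; ↭-sym; ↭-trans; ↭-refl)
open import Data.List.Relation.Binary.Permutation.Propositional.Properties
  using (All-resp-↭; ∈-resp-↭; ++-comm; shift; ↭-reverse; ↭-length)
import Data.List.Relation.Binary.Permutation.Setoid.Properties as ↭ₛ
open import Data.List.Relation.Unary.All as All using (All; []; _∷_)
open import Data.List.Relation.Unary.All.Properties using (++⁺; ++⁻ˡ; ++⁻ʳ; map⁺)
open import Data.List.Relation.Unary.AllPairs as AllPairs using ([]; _∷_)
open import Data.List.Relation.Unary.Any using (here; there)
open import Data.List.Relation.Unary.Unique.Propositional using (Unique)
import Data.List.Relation.Unary.Unique.Propositional.Properties as Unique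
open import Data.Maybe using (Maybe; just; nothing; maybe′)
open import Data.Nat using (ℕ; zero; suc; _+_; _*_; _∸_; _≤_; _<_; z≤n; s≤s; _≡ᵇ_; _<ᵇ_)
open import Data.Nat.Divisibility using (_∣_; divides; _∣0; ∣m∣n⇒∣m+n; ∣m+n∣m⇒∣n)
open import Data.Nat.Properties
  using (+-comm; +-assoc; +-suc; +-identityʳ; *-comm; ≤-refl; ≤-reflexive; ≤-trans; ≤-pred; ≤-<-trans;
         n≤1+n; m≤n⇒m≤1+n; m≤m+n; m≤n+m; m+[n∸m]≡n; <⇒≢; <⇒≤; <⇒≱; ≤∧≢⇒<; n≮n; ≡ᵇ⇒≡)
open import Data.Nat.Solver using (module +-*-Solver)
open +-*-Solver using (solve; _:+_; _:*_; _:=_; con)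
open import Data.Product as Prod using (Σ; ∃; _×_; _,_; proj₁; proj₂)
open import Data.Sum using (_⊎_; inj₁; inj₂)
open import Function using (_∘_)
open import Function.Bundles using (_⇔_; Equivalence)
open import Relation.Binary.Construct.Closure.ReflexiveTransitive using (ε; _◅_)
open import Relation.Binary.PropositionalEquality
  using (_≡_; _≢_; refl; sym; trans; cong; cong₂; subst; module ≡-Reasoning)
open import Relation.Binary.PropositionalEquality.Properties using (isEquivalence; setoid)
open import Relation.Nullary using (yes; no; Dec)
open import Relation.Nullary.Decidable using (⌊_⌋)

private variable
  A B : Set

bit : Bool → ℕ
bit b = if b then 1 else 0

final : A → List A → A
final a []       = a
final a (b ∷ bs) = final b bs

final-snoc : (b : A) (bs : List A) (a : A) → final b (bs ++ [ a ]) ≡ a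
final-snoc b []       a = refl
final-snoc b (x ∷ bs) a = final-snoc x bs a

final-map : (f : A → B) (x : A) (xs : List A) → final (f x) (map f xs) ≡ f (final x xs)
final-map f x []       = refl
final-map f x (y ∷ xs) = final-map f y xs

pathEdges : List A → List (A × A)
pathEdges []       = []
pathEdges (x ∷ xs) = consec x xs

consec-++ : (a : A) (xs : List A) (b : A) (ys : List A) →
  consec a (xs ++ b ∷ ys) ≡ consec a xs ++ (final a xs , b) ∷ consec b ys
consec-++ a []       b ys = refl
consec-++ a (x ∷ xs) b ys = cong ((a , x) ∷_) (consec-++ x xs b ys)

consec-snoc : (a : A) (xs : List A) (b : A) →
  consec a (xs ++ [ b ]) ≡ consec a xs ++ [ (final a xs , b) ]
consec-snoc a xs b = consec-++ a xs b []

_×ᶠ_ : (A → B) → A × A → B × B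
(f ×ᶠ e) = f (proj₁ e) , f (proj₂ e)

consec-map : (f : A → B) (a : A) (xs : List A) →
  consec (f a) (map f xs) ≡ map (f ×ᶠ_) (consec a xs)
consec-map f a []       = refl
consec-map f a (x ∷ xs) = cong ((f a , f x) ∷_) (consec-map f x xs)

cycEdges-map : (f : A → B) (xs : List A) → cycEdges (map f xs) ≡ map (f ×ᶠ_) (cycEdges xs)
cycEdges-map f []       = refl
cycEdges-map f (x ∷ xs) =
  trans (cong (consec (f x)) (sym (map-++ f xs [ x ]))) (consec-map f x (xs ++ [ x ]))

length-consec : (a : A) (xs : List A) → length (consec a xs) ≡ length xs
length-consec a []       = refl
length-consec a (x ∷ xs) = cong suc (length-consec x xs)

length-cycEdges : (xs : List A) → length (cycEdges xs) ≡ length xs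
length-cycEdges []       = refl
length-cycEdges (x ∷ xs) =
  trans (length-consec x (xs ++ [ x ])) (trans (length-++ xs) (+-comm (length xs) 1))

cycEdges-rotate₁ : (a : A) (bs : List A) → cycEdges (a ∷ bs) ↭ cycEdges (bs ++ [ a ])
cycEdges-rotate₁ a []       = ↭-refl
cycEdges-rotate₁ a (b ∷ bs) =
  subst ((a , b) ∷ consec b (bs ++ [ a ]) ↭_) (sym wrap) (++-comm [ (a , b) ] (consec b (bs ++ [ a ])))
  where
  wrap : consec b ((bs ++ [ a ]) ++ [ b ]) ≡ consec b (bs ++ [ a ]) ++ [ (a , b) ]
  wrap = trans (consec-snoc b (bs ++ [ a ]) b)
               (cong (λ z → consec b (bs ++ [ a ]) ++ [ (z , b) ]) (final-snoc b bs a))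

cycEdges-rotate : (xs ys : List A) → cycEdges (xs ++ ys) ↭ cycEdges (ys ++ xs)
cycEdges-rotate []       ys = subst (λ L → cycEdges ys ↭ cycEdges L) (sym (++-identityʳ ys)) ↭-refl
cycEdges-rotate (x ∷ xs) ys = ↭-trans (cycEdges-rotate₁ x (xs ++ ys))
  (subst (λ L → cycEdges L ↭ cycEdges (ys ++ x ∷ xs)) (sym (++-assoc xs ys [ x ]))
    (subst (λ L → cycEdges (xs ++ ys ++ [ x ]) ↭ cycEdges L) (++-assoc ys [ x ] xs)
      (cycEdges-rotate xs (ys ++ [ x ]))))

rotate-↭ : (xs : List A) (c : A) (ys : List A) → xs ++ c ∷ ys ↭ c ∷ ys ++ xs
rotate-↭ xs c ys = ↭-trans (shift c xs ys) (prep c (++-comm xs ys))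

pathEdges-snoc : (xs : List A) (y x : A) →
  pathEdges (xs ++ y ∷ [ x ]) ≡ pathEdges (xs ++ [ y ]) ++ [ (y , x) ]
pathEdges-snoc []       y x = refl
pathEdges-snoc (l ∷ xs) y x = begin
    consec l (xs ++ y ∷ [ x ])
  ≡⟨ consec-++ l xs y [ x ] ⟩
    consec l xs ++ (final l xs , y) ∷ [ (y , x) ]
  ≡⟨ ++-assoc (consec l xs) [ (final l xs , y) ] [ (y , x) ] ⟨
    (consec l xs ++ [ (final l xs , y) ]) ++ [ (y , x) ]
  ≡⟨ cong (_++ [ (y , x) ]) (consec-snoc l xs y) ⟨
    consec l (xs ++ [ y ]) ++ [ (y , x) ] ∎
  where open ≡-Reasoning

pathEdges-reverse : (xs : List A) → pathEdges (reverse xs) ≡ reverse (map Prod.swap (pathEdges xs))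
pathEdges-reverse []           = refl
pathEdges-reverse (x ∷ [])     = refl
pathEdges-reverse (x ∷ y ∷ ys) = begin
    pathEdges (reverse (x ∷ y ∷ ys))
  ≡⟨ cong pathEdges (trans (unfold-reverse x (y ∷ ys)) (cong (_++ [ x ]) (unfold-reverse y ys))) ⟩
    pathEdges ((reverse ys ++ [ y ]) ++ [ x ])
  ≡⟨ cong pathEdges (++-assoc (reverse ys) [ y ] [ x ]) ⟩
    pathEdges (reverse ys ++ y ∷ [ x ])
  ≡⟨ pathEdges-snoc (reverse ys) y x ⟩
    pathEdges (reverse ys ++ [ y ]) ++ [ (y , x) ]
  ≡⟨ cong (λ L → pathEdges L ++ [ (y , x) ]) (unfold-reverse y ys) ⟨
    pathEdges (reverse (y ∷ ys)) ++ [ (y , x) ]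
  ≡⟨ cong (_++ [ (y , x) ]) (pathEdges-reverse (y ∷ ys)) ⟩
    reverse (map Prod.swap (pathEdges (y ∷ ys))) ++ [ (y , x) ]
  ≡⟨ unfold-reverse (y , x) (map Prod.swap (pathEdges (y ∷ ys))) ⟨
    reverse (map Prod.swap (pathEdges (x ∷ y ∷ ys))) ∎
  where open ≡-Reasoning

cycEdges-reverse : (xs : List A) → cycEdges (reverse xs) ↭ map Prod.swap (cycEdges xs)
cycEdges-reverse []       = ↭-refl
cycEdges-reverse (x ∷ xs) = ↭-trans
  (subst (λ L → cycEdges L ↭ cycEdges (x ∷ reverse xs)) (sym (unfold-reverse x xs))
    (cycEdges-rotate (reverse xs) [ x ]))
  (subst (_↭ map Prod.swap (cycEdges (x ∷ xs))) (sym reversed)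
    (↭-reverse (map Prod.swap (cycEdges (x ∷ xs)))))
  where
  reversed : cycEdges (x ∷ reverse xs) ≡ reverse (map Prod.swap (cycEdges (x ∷ xs)))
  reversed = begin
      pathEdges ((x ∷ reverse xs) ++ [ x ])
    ≡⟨ cong (λ L → pathEdges (L ++ [ x ])) (reverse-++ xs [ x ]) ⟨
      pathEdges (reverse (xs ++ [ x ]) ++ [ x ])
    ≡⟨ cong pathEdges (unfold-reverse x (xs ++ [ x ])) ⟨
      pathEdges (reverse (x ∷ xs ++ [ x ]))
    ≡⟨ pathEdges-reverse (x ∷ xs ++ [ x ]) ⟩
      reverse (map Prod.swap (cycEdges (x ∷ xs))) ∎
    where open ≡-Reasoning

reverseTail : A → List A → List A
reverseTail h []       = []
reverseTail h (s ∷ ss) = reverseTail s ss ++ [ h ]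

reverse-∷ : (h : A) (ss : List A) → reverse (h ∷ ss) ≡ final h ss ∷ reverseTail h ss
reverse-∷ h []       = refl
reverse-∷ h (s ∷ ss) = trans (unfold-reverse h (s ∷ ss)) (cong (_++ [ h ]) (reverse-∷ s ss))

Both : (A → Set) → A × A → Set
Both Q e = Q (proj₁ e) × Q (proj₂ e)

All-consec : {Q : A → Set} (a : A) (xs : List A) → All Q (a ∷ xs) → All (Both Q) (consec a xs)
All-consec a []       _                = []
All-consec a (x ∷ xs) (qa ∷ qx ∷ qs) = (qa , qx) ∷ All-consec x xs (qx ∷ qs)

All-cycEdges : {Q : A → Set} (xs : List A) → All Q xs → All (Both Q) (cycEdges xs)
All-cycEdges []       _        = []
All-cycEdges (x ∷ xs) (q ∷ qs) = All-consec x (xs ++ [ x ]) (q ∷ ++⁺ qs (q ∷ []))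

Unique-resp-↭ : {xs ys : List A} → xs ↭ ys → Unique xs → Unique ys
Unique-resp-↭ {A} xs↭ys = ↭ₛ.Unique-resp-↭ (setoid A) (↭.↭⇒↭ₛ′ isEquivalence xs↭ys)

Unique-snoc : {xs : List A} {y : A} → All (_≢ y) xs → Unique xs → Unique (xs ++ [ y ])
Unique-snoc []       []      = [] ∷ []
Unique-snoc (n ∷ ns) (a ∷ u) = ++⁺ a (n ∷ []) ∷ Unique-snoc ns u

Unique-map-on : {R : A → Set} (f : A → B) → (∀ {x y} → R x → R y → f x ≡ f y → x ≡ y) →
  {xs : List A} → All R xs → Unique xs → Unique (map f xs)
Unique-map-on f inj []         []      = []
Unique-map-on {R = R} f inj {x ∷ _} (rx ∷ rxs) (a ∷ u) = images a rxs ∷ Unique-map-on f inj rxs u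
  where
  images : ∀ {zs} → All (x ≢_) zs → All R zs → All (f x ≢_) (map f zs)
  images []       []         = []
  images (n ∷ ns) (rz ∷ rzs) = (λ e → n (inj rx rz e)) ∷ images ns rzs

countᵇ-++ : (p : A → Bool) (xs ys : List A) → countᵇ p (xs ++ ys) ≡ countᵇ p xs + countᵇ p ys
countᵇ-++ p []       ys = refl
countᵇ-++ p (x ∷ xs) ys =
  trans (cong (bit (p x) +_) (countᵇ-++ p xs ys)) (sym (+-assoc (bit (p x)) _ _))

countᵇ-↭ : (p : A → Bool) {xs ys : List A} → xs ↭ ys → countᵇ p xs ≡ countᵇ p ys
countᵇ-↭ p ↭.refl                                = refl
countᵇ-↭ p (prep x q)                            = cong (bit (p x) +_) (countᵇ-↭ p q)
countᵇ-↭ p {x ∷ y ∷ xs} {y ∷ x ∷ ys} (swap x y q) = begin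
    bit (p x) + (bit (p y) + countᵇ p xs)
  ≡⟨ +-assoc (bit (p x)) _ _ ⟨
    (bit (p x) + bit (p y)) + countᵇ p xs
  ≡⟨ cong (_+ countᵇ p xs) (+-comm (bit (p x)) (bit (p y))) ⟩
    (bit (p y) + bit (p x)) + countᵇ p xs
  ≡⟨ +-assoc (bit (p y)) _ _ ⟩
    bit (p y) + (bit (p x) + countᵇ p xs)
  ≡⟨ cong (λ k → bit (p y) + (bit (p x) + k)) (countᵇ-↭ p q) ⟩
    bit (p y) + (bit (p x) + countᵇ p ys) ∎
  where open ≡-Reasoning
countᵇ-↭ p (↭.trans q r)                         = trans (countᵇ-↭ p q) (countᵇ-↭ p r)

countᵇ-map : (p : B → Bool) (f : A → B) (xs : List A) →
  countᵇ p (map f xs) ≡ countᵇ (λ x → p (f x)) xs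
countᵇ-map p f []       = refl
countᵇ-map p f (x ∷ xs) = cong (bit (p (f x)) +_) (countᵇ-map p f xs)

countᵇ-consec-map : (q : B × B → Bool) (f : A → B) (a : A) (xs : List A) →
  countᵇ q (consec (f a) (map f xs)) ≡ countᵇ (λ e → q (f ×ᶠ e)) (consec a xs)
countᵇ-consec-map q f a xs = trans (cong (countᵇ q) (consec-map f a xs)) (countᵇ-map q (f ×ᶠ_) (consec a xs))

countᵇ-cong : {p q : A → Bool} (xs : List A) → (∀ x → p x ≡ q x) → countᵇ p xs ≡ countᵇ q xs
countᵇ-cong []       e = refl
countᵇ-cong (x ∷ xs) e = cong₂ (λ b k → bit b + k) (e x) (countᵇ-cong xs e)

countᵇ-cong-on : {p q : A → Bool} {xs : List A} → All (λ x → p x ≡ q x) xs →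
  countᵇ p xs ≡ countᵇ q xs
countᵇ-cong-on []       = refl
countᵇ-cong-on (e ∷ es) = cong₂ (λ b k → bit b + k) e (countᵇ-cong-on es)

countᵇ-all : {p : A → Bool} {xs : List A} → All (λ x → p x ≡ true) xs → countᵇ p xs ≡ length xs
countᵇ-all []       = refl
countᵇ-all (e ∷ es) rewrite e = cong suc (countᵇ-all es)

countᵇ-none : {p : A → Bool} {xs : List A} → All (λ x → p x ≡ false) xs → countᵇ p xs ≡ 0
countᵇ-none []       = refl
countᵇ-none (e ∷ es) rewrite e = countᵇ-none es

countᵇ-complement : (p : A → Bool) (xs : List A) →
  countᵇ p xs + countᵇ (λ x → not (p x)) xs ≡ length xs
countᵇ-complement p []       = refl
countᵇ-complement p (x ∷ xs) with p x
... | true  = cong suc (countᵇ-complement p xs)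
... | false = trans (+-suc _ _) (cong suc (countᵇ-complement p xs))

countᵇ-∧ : (β : Bool) (f : A → Bool) (xs : List A) →
  countᵇ (λ x → β ∧ f x) xs ≡ (if β then countᵇ f xs else 0)
countᵇ-∧ true  f xs       = refl
countᵇ-∧ false f []       = refl
countᵇ-∧ false f (x ∷ xs) = countᵇ-∧ false f xs

0<ᵇbits : ∀ x y → (0 <ᵇ (bit x + (bit y + 0))) ≡ (x ∨ y)
0<ᵇbits true  y     = refl
0<ᵇbits false true  = refl
0<ᵇbits false false = refl

∧∨-merge : ∀ a a₁ a₂ e₁ e₂ → (e₁ ≡ true → a₁ ≡ a) → (e₂ ≡ true → a₂ ≡ a) →
  ((a₁ ∧ e₁) ∨ (e₂ ∧ a₂)) ≡ (a ∧ (e₁ ∨ e₂))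
∧∨-merge a a₁ a₂ true  true  k₁ k₂ rewrite k₁ refl | k₂ refl | ∧-identityʳ a = ∨-idem a
∧∨-merge a a₁ a₂ true  false k₁ k₂ rewrite k₁ refl | ∧-identityʳ a = ∨-identityʳ a
∧∨-merge a a₁ a₂ false true  k₁ k₂ rewrite k₂ refl | ∧-zeroʳ a₁ | ∧-identityʳ a = refl
∧∨-merge a a₁ a₂ false false k₁ k₂ rewrite ∧-zeroʳ a₁ | ∧-zeroʳ a = refl

module _ {P : A → Set} where

  length-reduce : (f : ∀ {x} → P x → B) {xs : List A} (pxs : All P xs) → length (All.reduce f pxs) ≡ length xs
  length-reduce f []         = refl
  length-reduce f (px ∷ pxs) = cong suc (length-reduce f pxs)

  countᵇ-reduce : (q : B → Bool) (f : ∀ {x} → P x → B) (g : A → Bool) → (∀ {x} (px : P x) → q (f px) ≡ g x) →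
    {xs : List A} (pxs : All P xs) → countᵇ q (All.reduce f pxs) ≡ countᵇ g xs
  countᵇ-reduce q f g e []         = refl
  countᵇ-reduce q f g e (px ∷ pxs) = cong₂ (λ b k → bit b + k) (e px) (countᵇ-reduce q f g e pxs)

  countᵇ-reduce₂ : {C : Set} (q : B → Bool) (f : ∀ {x} → P x → B) (q′ : C → Bool) (f′ : ∀ {x} → P x → C) →
    (∀ {x} (px : P x) → q (f px) ≡ q′ (f′ px)) →
    {xs : List A} (pxs : All P xs) → countᵇ q (All.reduce f pxs) ≡ countᵇ q′ (All.reduce f′ pxs)
  countᵇ-reduce₂ q f q′ f′ e []         = refl
  countᵇ-reduce₂ q f q′ f′ e (px ∷ pxs) = cong₂ (λ b k → bit b + k) (e px) (countᵇ-reduce₂ q f q′ f′ e pxs)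

  All-reduce : {R : A → Set} {Q : B → Set} (f : ∀ {x} → P x → B) → (∀ {x} (px : P x) → R x → Q (f px)) →
    {xs : List A} (pxs : All P xs) → All R xs → All Q (All.reduce f pxs)
  All-reduce f q []         []         = []
  All-reduce f q (px ∷ pxs) (rx ∷ rxs) = q px rx ∷ All-reduce f q pxs rxs

lookupOr : List A → ℕ → A → A
lookupOr []       k       d = d
lookupOr (x ∷ xs) zero    d = x
lookupOr (x ∷ xs) (suc k) d = lookupOr xs k d

lookupOr∈ : (xs : List A) (k : ℕ) (d : A) → k < length xs → lookupOr xs k d ∈ xs
lookupOr∈ (x ∷ xs) zero    d _         = here refl
lookupOr∈ (x ∷ xs) (suc k) d (s≤s k<) = there (lookupOr∈ xs k d k<)

lookupOr-++ : (xs : List A) (y : A) (ys : List A) (d : A) → lookupOr (xs ++ y ∷ ys) (length xs) d ≡ y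
lookupOr-++ []       y ys d = refl
lookupOr-++ (x ∷ xs) y ys d = lookupOr-++ xs y ys d

pathEdges-lookupOr : {R : A × A → Set} (xs : List A) (k : ℕ) (d : A) →
  suc k < length xs → All R (pathEdges xs) → R (lookupOr xs k d , lookupOr xs (suc k) d)
pathEdges-lookupOr (x ∷ [])     zero    d (s≤s ()) _
pathEdges-lookupOr (x ∷ y ∷ xs) zero    d _         (r ∷ _)  = r
pathEdges-lookupOr (x ∷ y ∷ xs) (suc k) d (s≤s k<) (_ ∷ rs) = pathEdges-lookupOr (y ∷ xs) k d k< rs

module _ {A : Set} (_≟_ : (a b : A) → Dec (a ≡ b)) where

  position : A → List A → ℕ
  position a []       = 0
  position a (x ∷ xs) with a ≟ x
  ... | yes _ = 0
  ... | no _  = suc (position a xs)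

  position-here : (a : A) (xs : List A) → position a (a ∷ xs) ≡ 0
  position-here a xs with a ≟ a
  ... | yes _ = refl
  ... | no ne = ⊥-elim (ne refl)

  position-there : (a x : A) (xs : List A) → a ≢ x → position a (x ∷ xs) ≡ suc (position a xs)
  position-there a x xs ne with a ≟ x
  ... | yes e = ⊥-elim (ne e)
  ... | no _  = refl

  position< : (a : A) (xs : List A) → a ∈ xs → position a xs < length xs
  position< a (x ∷ xs) m with a ≟ x
  ... | yes _ = s≤s z≤n
  position< a (x ∷ xs) (here e)  | no ne = ⊥-elim (ne e)
  position< a (x ∷ xs) (there m) | no ne = s≤s (position< a xs m)

  lookupOr-position : (a d : A) (xs : List A) → a ∈ xs → lookupOr xs (position a xs) d ≡ a
  lookupOr-position a d (x ∷ xs) m with a ≟ x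
  ... | yes e = sym e
  lookupOr-position a d (x ∷ xs) (here e)  | no ne = ⊥-elim (ne e)
  lookupOr-position a d (x ∷ xs) (there m) | no ne = lookupOr-position a d xs m

  position-lookupOr : (xs : List A) (k : ℕ) (d : A) → Unique xs → k < length xs →
    position (lookupOr xs k d) xs ≡ k
  position-lookupOr (x ∷ xs) zero    d u         _         = position-here x xs
  position-lookupOr (x ∷ xs) (suc k) d (x∉ ∷ u) (s≤s k<) = trans
    (position-there (lookupOr xs k d) x xs (λ e → All.lookup x∉ (lookupOr∈ xs k d k<) (sym e)))
    (cong suc (position-lookupOr xs k d u k<))

  position-injective : (a b : A) (xs : List A) → a ∈ xs → b ∈ xs →
    position a xs ≡ position b xs → a ≡ b
  position-injective a b xs a∈ b∈ e = trans (sym (lookupOr-position a a xs a∈))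
    (trans (cong (λ k → lookupOr xs k a) e) (lookupOr-position b a xs b∈))

-- Matching the indices 2i ↔ 2i+1

evenᵇ : ℕ → Bool
evenᵇ zero          = true
evenᵇ (suc zero)    = false
evenᵇ (suc (suc n)) = evenᵇ n

evenᵇ-suc : ∀ j → evenᵇ (suc j) ≡ not (evenᵇ j)
evenᵇ-suc zero          = refl
evenᵇ-suc (suc zero)    = refl
evenᵇ-suc (suc (suc j)) = evenᵇ-suc j

evenᵇ-double : ∀ t → evenᵇ (t + t) ≡ true
evenᵇ-double zero    = refl
evenᵇ-double (suc t) rewrite +-suc t t = evenᵇ-double t

evenᵇ-suc-double : ∀ t → evenᵇ (suc (t + t)) ≡ false
evenᵇ-suc-double zero    = refl
evenᵇ-suc-double (suc t) rewrite +-suc t t = evenᵇ-suc-double t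

even-or-odd : ∀ j → (evenᵇ j ≡ true × ∃ λ t → j ≡ t + t) ⊎ (evenᵇ j ≡ false × ∃ λ t → j ≡ suc (t + t))
even-or-odd zero          = inj₁ (refl , 0 , refl)
even-or-odd (suc zero)    = inj₂ (refl , 0 , refl)
even-or-odd (suc (suc j)) with even-or-odd j
... | inj₁ (e , t , refl) = inj₁ (e , suc t , cong suc (sym (+-suc t t)))
... | inj₂ (e , t , refl) = inj₂ (e , suc t , cong (λ z → suc (suc z)) (sym (+-suc t t)))

2∣double : ∀ t → 2 ∣ (t + t)
2∣double t = divides t (trans (cong (t +_) (sym (+-identityʳ t))) (*-comm 2 t))

double-∸ : ∀ m a → a ≤ m → (m + m) ∸ (a + a) ≡ (m ∸ a) + (m ∸ a)
double-∸ m       zero    _         = refl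
double-∸ (suc m) (suc a) (s≤s a≤m) rewrite +-suc m m | +-suc a a = double-∸ m a a≤m

double-≤-cancel : ∀ a m → a + a ≤ m + m → a ≤ m
double-≤-cancel zero    m       _  = z≤n
double-≤-cancel (suc a) zero    ()
double-≤-cancel (suc a) (suc m) le rewrite +-suc a a | +-suc m m =
  s≤s (double-≤-cancel a m (≤-pred (≤-pred le)))

partner : ℕ → ℕ
partner zero          = 1
partner (suc zero)    = 0
partner (suc (suc n)) = suc (suc (partner n))

partner-involutive : ∀ k → partner (partner k) ≡ k
partner-involutive zero          = refl
partner-involutive (suc zero)    = refl
partner-involutive (suc (suc k)) = cong (λ z → suc (suc z)) (partner-involutive k)

partner-even : ∀ i → evenᵇ i ≡ true → partner i ≡ suc i
partner-even zero          _ = refl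
partner-even (suc (suc i)) e = cong (λ z → suc (suc z)) (partner-even i e)

partner-odd : ∀ i → evenᵇ i ≡ false → suc (partner i) ≡ i
partner-odd (suc zero)    _ = refl
partner-odd (suc (suc i)) e = cong (λ z → suc (suc z)) (partner-odd i e)

suc≡ᵇpartner : ∀ k → (suc k ≡ᵇ partner k) ≡ evenᵇ k
suc≡ᵇpartner zero          = refl
suc≡ᵇpartner (suc zero)    = refl
suc≡ᵇpartner (suc (suc k)) = suc≡ᵇpartner k

≡ᵇpartner-suc : ∀ k → (k ≡ᵇ partner (suc k)) ≡ evenᵇ k
≡ᵇpartner-suc zero          = refl
≡ᵇpartner-suc (suc zero)    = refl
≡ᵇpartner-suc (suc (suc k)) = ≡ᵇpartner-suc k

≡ᵇ-sound : ∀ {a b} → (a ≡ᵇ b) ≡ true → a ≡ b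
≡ᵇ-sound {a} {b} e = ≡ᵇ⇒≡ a b (subst T (sym e) _)

≡ᵇ-refl : ∀ a → (a ≡ᵇ a) ≡ true
≡ᵇ-refl zero    = refl
≡ᵇ-refl (suc a) = ≡ᵇ-refl a

≡ᵇ-complete : ∀ {a b} → a ≡ b → (a ≡ᵇ b) ≡ true
≡ᵇ-complete {a} refl = ≡ᵇ-refl a

≡ᵇ-false : ∀ {a b} → a ≢ b → (a ≡ᵇ b) ≡ false
≡ᵇ-false {a} {b} ne with a ≡ᵇ b in eq
... | true  = ⊥-elim (ne (≡ᵇ-sound eq))
... | false = refl

≡ᵇpartner-sym : ∀ i j → (j ≡ᵇ partner i) ≡ (i ≡ᵇ partner j)
≡ᵇpartner-sym i j with j ≡ᵇ partner i in eq
... | true = sym (≡ᵇ-complete (trans (sym (partner-involutive i)) (cong partner (sym (≡ᵇ-sound eq)))))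
... | false with i ≡ᵇ partner j in eq′
...   | false = refl
...   | true  = trans (sym eq) (≡ᵇ-complete (sym (trans (cong partner (≡ᵇ-sound eq′)) (partner-involutive j))))

<ᵇ-suc : ∀ k → (k <ᵇ suc k) ≡ true
<ᵇ-suc zero    = refl
<ᵇ-suc (suc k) = <ᵇ-suc k

suc<ᵇ : ∀ k → (suc k <ᵇ k) ≡ false
suc<ᵇ zero    = refl
suc<ᵇ (suc k) = suc<ᵇ k

<ᵇ-flip : ∀ i j → i ≢ j → (j <ᵇ i) ≡ not (i <ᵇ j)
<ᵇ-flip zero    zero    ne = ⊥-elim (ne refl)
<ᵇ-flip zero    (suc j) ne = refl
<ᵇ-flip (suc i) zero    ne = refl
<ᵇ-flip (suc i) (suc j) ne = <ᵇ-flip i j (λ e → ne (cong suc e))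

-- The cyclic orientation 0 → 1 → ⋯ → K → 0 of a cycle of length K + 1,
-- extended to chords by orienting them towards the larger index.
cyclicᵇ : ℕ → ℕ → ℕ → Bool
cyclicᵇ K i l = ((i ≡ᵇ K) ∧ (l ≡ᵇ 0)) ∨ (not ((l ≡ᵇ K) ∧ (i ≡ᵇ 0)) ∧ (i <ᵇ l))

cyclicᵇ-flip : ∀ K i l → i ≢ l → cyclicᵇ K l i ≡ not (cyclicᵇ K i l)
cyclicᵇ-flip K i l i≢l rewrite <ᵇ-flip i l i≢l =
  flip ((i ≡ᵇ K) ∧ (l ≡ᵇ 0)) ((l ≡ᵇ K) ∧ (i ≡ᵇ 0)) (i <ᵇ l) not-both
  where
  flip : ∀ x y b → (x ∧ y) ≡ false → (y ∨ (not x ∧ not b)) ≡ not (x ∨ (not y ∧ b))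
  flip true  true  b     ()
  flip true  false b     _ = refl
  flip false true  b     _ = refl
  flip false false true  _ = refl
  flip false false false _ = refl
  not-both : (((i ≡ᵇ K) ∧ (l ≡ᵇ 0)) ∧ ((l ≡ᵇ K) ∧ (i ≡ᵇ 0))) ≡ false
  not-both with i ≡ᵇ K in iK | l ≡ᵇ K in lK
  ... | true  | true  = ⊥-elim (i≢l (trans (≡ᵇ-sound iK) (sym (≡ᵇ-sound lK))))
  ... | false | _     = refl
  ... | true  | false = ∧-zeroʳ (l ≡ᵇ 0)

cyclicᵇ-up : ∀ {K} k → 2 ≤ K → suc k ≤ K → cyclicᵇ K k (suc k) ≡ true
cyclicᵇ-up {K} zero    2≤K _ rewrite ≡ᵇ-false {1} {K} (<⇒≢ 2≤K) | ∧-zeroʳ (0 ≡ᵇ K) = refl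
cyclicᵇ-up {K} (suc k) _   _ rewrite ∧-zeroʳ (suc k ≡ᵇ K) | ∧-zeroʳ (suc (suc k) ≡ᵇ K) | <ᵇ-suc k = refl

cyclicᵇ-down : ∀ {K} k → suc k < K → cyclicᵇ K (suc k) k ≡ false
cyclicᵇ-down {K} k k<K rewrite ≡ᵇ-false {suc k} {K} (<⇒≢ k<K) | suc<ᵇ k
  | ∧-zeroʳ (not ((k ≡ᵇ K) ∧ false)) = refl

cyclicᵇ-wrap : ∀ {K} → 2 ≤ K → cyclicᵇ K 0 K ≡ false
cyclicᵇ-wrap {K} 2≤K rewrite ≡ᵇ-false {0} {K} (<⇒≢ (≤-trans (s≤s z≤n) 2≤K)) | ≡ᵇ-refl K = refl

stepsUp : ℕ → ℕ → List ℕ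
stepsUp j zero    = []
stepsUp j (suc d) = suc j ∷ stepsUp (suc j) d

length-stepsUp : ∀ j d → length (stepsUp j d) ≡ d
length-stepsUp j zero    = refl
length-stepsUp j (suc d) = cong suc (length-stepsUp (suc j) d)

final-stepsUp : ∀ j d → final j (stepsUp j d) ≡ j + d
final-stepsUp j zero    = sym (+-identityʳ j)
final-stepsUp j (suc d) = trans (final-stepsUp (suc j) d) (sym (+-suc j d))

final-downFrom : ∀ j → final j (downFrom j) ≡ 0
final-downFrom zero    = refl
final-downFrom (suc j) = final-downFrom j

consec-stepsUp : ∀ j d → All (λ e → proj₂ e ≡ suc (proj₁ e) × proj₂ e ≤ j + d) (consec j (stepsUp j d))
consec-stepsUp j zero    = []
consec-stepsUp j (suc d) = (refl , subst (suc j ≤_) (sym (+-suc j d)) (s≤s (m≤m+n j d))) ∷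
  All.map (λ {e} (s , le) → s , subst (proj₂ e ≤_) (sym (+-suc j d)) le) (consec-stepsUp (suc j) d)

consec-downFrom : ∀ j → All (λ e → proj₁ e ≡ suc (proj₂ e) × proj₁ e ≤ j) (consec j (downFrom j))
consec-downFrom zero    = []
consec-downFrom (suc j) = (refl , ≤-refl) ∷ All.map (λ (s , le) → s , m≤n⇒m≤1+n le) (consec-downFrom j)

stepsUp-bounds : ∀ j d → All (λ k → j ≤ k × k ≤ j + d) (j ∷ stepsUp j d)
stepsUp-bounds j zero    = (≤-refl , m≤m+n j 0) ∷ []
stepsUp-bounds j (suc d) = (≤-refl , m≤m+n j (suc d)) ∷
  All.map (λ {k} (lo , hi) → ≤-trans (n≤1+n j) lo , subst (k ≤_) (sym (+-suc j d)) hi) (stepsUp-bounds (suc j) d)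

downFrom-bounds : ∀ j → All (_≤ j) (j ∷ downFrom j)
downFrom-bounds zero    = ≤-refl ∷ []
downFrom-bounds (suc j) = ≤-refl ∷ All.map m≤n⇒m≤1+n (downFrom-bounds j)

Unique-stepsUp : ∀ j d → Unique (j ∷ stepsUp j d)
Unique-stepsUp j zero    = [] ∷ []
Unique-stepsUp j (suc d) =
  All.map (λ (lo , _) → <⇒≢ lo) (stepsUp-bounds (suc j) d) ∷ Unique-stepsUp (suc j) d

Unique-downFrom : ∀ j → Unique (j ∷ downFrom j)
Unique-downFrom zero    = [] ∷ []
Unique-downFrom (suc j) = All.map (λ le e → <⇒≢ (s≤s le) (sym e)) (downFrom-bounds j) ∷ Unique-downFrom j

countᵇ-even-stepsUp : ∀ t j → evenᵇ j ≡ true →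
  countᵇ (λ e → evenᵇ (proj₁ e)) (consec j (stepsUp j (t + t))) ≡ t
countᵇ-even-stepsUp zero    j e = refl
countᵇ-even-stepsUp (suc t) j e rewrite +-suc t t | evenᵇ-suc j | e =
  cong suc (countᵇ-even-stepsUp t (suc (suc j)) e)

countᵇ-even-downFrom : ∀ t →
  countᵇ (λ e → evenᵇ (proj₂ e)) (consec (suc (t + t)) (downFrom (suc (t + t)))) ≡ suc t
countᵇ-even-downFrom zero    = refl
countᵇ-even-downFrom (suc t) rewrite +-suc t t | evenᵇ-double t | evenᵇ-suc-double t =
  cong suc (subst (λ b → bit b + countᵇ (λ e → evenᵇ (proj₂ e)) (consec (t + t) (downFrom (t + t))) ≡ suc t)
    (evenᵇ-double t) (countᵇ-even-downFrom t))

sumFin : ∀ {N} → (Fin N → ℕ) → ℕ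
sumFin {zero}  f = 0
sumFin {suc N} f = f zero + sumFin (λ y → f (suc y))

sumFin-cong : ∀ {N} {f h : Fin N → ℕ} → (∀ y → f y ≡ h y) → sumFin f ≡ sumFin h
sumFin-cong {zero}  e = refl
sumFin-cong {suc N} e = cong₂ _+_ (e zero) (sumFin-cong (λ y → e (suc y)))

sumFin-+ : ∀ {N} (f h : Fin N → ℕ) → sumFin (λ y → f y + h y) ≡ sumFin f + sumFin h
sumFin-+ {zero}  f h = refl
sumFin-+ {suc N} f h = begin
    (f zero + h zero) + sumFin (λ y → f (suc y) + h (suc y))
  ≡⟨ cong ((f zero + h zero) +_) (sumFin-+ (λ y → f (suc y)) (λ y → h (suc y))) ⟩
    (f zero + h zero) + (sumFin (λ y → f (suc y)) + sumFin (λ y → h (suc y)))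
  ≡⟨ solve 4 (λ a b c d → (a :+ b) :+ (c :+ d) := (a :+ c) :+ (b :+ d)) refl
       (f zero) (h zero) (sumFin (λ y → f (suc y))) (sumFin (λ y → h (suc y))) ⟩
    (f zero + sumFin (λ y → f (suc y))) + (h zero + sumFin (λ y → h (suc y))) ∎
  where open ≡-Reasoning

sumFin-zero : ∀ {N} → sumFin {N} (λ _ → 0) ≡ 0
sumFin-zero {zero}  = refl
sumFin-zero {suc N} = sumFin-zero {N}

sumFin-point : ∀ {N} (z : Fin N) (f : Fin N → ℕ) → sumFin (λ y → if ⌊ z ≟F y ⌋ then f y else 0) ≡ f z
sumFin-point {suc N} zero    f = trans (cong (f zero +_) (sumFin-zero {N})) (+-identityʳ (f zero))
sumFin-point {suc N} (suc z) f =
  trans (sumFin-cong (λ y → cong (λ b → if b then f (suc y) else 0) (≟-suc y)))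
        (sumFin-point z (λ y → f (suc y)))
  where
  ≟-suc : ∀ y → ⌊ suc z ≟F suc y ⌋ ≡ ⌊ z ≟F y ⌋
  ≟-suc y with z ≟F y
  ... | yes _ = refl
  ... | no _  = refl

sumFin-even : ∀ {N} (f : Fin N → ℕ) → (∀ y → 2 ∣ f y) → 2 ∣ sumFin f
sumFin-even {zero}  f e = 2 ∣0
sumFin-even {suc N} f e = ∣m∣n⇒∣m+n (e zero) (sumFin-even (λ y → f (suc y)) (λ y → e (suc y)))

justᵇ : ∀ {N} → Fin N → Maybe (Fin N) → Bool
justᵇ y nothing  = false
justᵇ y (just z) = ⌊ z ≟F y ⌋

countᵇ-maybe : ∀ {N} (g : Fin N → Bool) (xs : List (Maybe (Fin N))) →
  countᵇ (maybe′ g false) xs ≡ sumFin (λ y → if g y then countᵇ (justᵇ y) xs else 0)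
countᵇ-maybe {N} g []       = sym (trans (sumFin-cong (λ y → if-0 (g y))) (sumFin-zero {N}))
  where
  if-0 : (b : Bool) → (if b then 0 else 0) ≡ 0
  if-0 true  = refl
  if-0 false = refl
countᵇ-maybe {N} g (x ∷ xs) = sym (begin
    sumFin (λ y → if g y then bit (justᵇ y x) + countᵇ (justᵇ y) xs else 0)
  ≡⟨ sumFin-cong (λ y → if-+ (g y) (bit (justᵇ y x)) (countᵇ (justᵇ y) xs)) ⟩
    sumFin (λ y → (if g y then bit (justᵇ y x) else 0) + (if g y then countᵇ (justᵇ y) xs else 0))
  ≡⟨ sumFin-+ {N} _ _ ⟩
    sumFin (λ y → if g y then bit (justᵇ y x) else 0) + sumFin (λ y → if g y then countᵇ (justᵇ y) xs else 0)
  ≡⟨ cong₂ _+_ (head x) (sym (countᵇ-maybe g xs)) ⟩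
    bit (maybe′ g false x) + countᵇ (maybe′ g false) xs ∎)
  where
  open ≡-Reasoning
  if-+ : (b : Bool) (m k : ℕ) → (if b then m + k else 0) ≡ (if b then m else 0) + (if b then k else 0)
  if-+ true  m k = refl
  if-+ false m k = refl
  swap-if : (a b : Bool) → (if a then bit b else 0) ≡ (if b then bit a else 0)
  swap-if true  true  = refl
  swap-if true  false = refl
  swap-if false true  = refl
  swap-if false false = refl
  head : (x : Maybe _) → sumFin (λ y → if g y then bit (justᵇ y x) else 0) ≡ bit (maybe′ g false x)
  head nothing  = trans (sumFin-cong (λ y → swap-if (g y) false)) (sumFin-zero {N})
  head (just z) = trans (sumFin-cong (λ y → swap-if (g y) (⌊ z ≟F y ⌋))) (sumFin-point z (λ y → bit (g y)))

countᵇ-maybe-even : ∀ {N} (g : Fin N → Bool) (xs : List (Maybe (Fin N))) →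
  (∀ y → 2 ∣ countᵇ (justᵇ y) xs) → 2 ∣ countᵇ (maybe′ g false) xs
countᵇ-maybe-even g xs evens = subst (2 ∣_) (sym (countᵇ-maybe g xs)) (sumFin-even _ even-term)
  where
  even-term : ∀ y → 2 ∣ (if g y then countᵇ (justᵇ y) xs else 0)
  even-term y with g y
  ... | true  = evens y
  ... | false = 2 ∣0

module _ {N : ℕ} where

  eqb : Fin N → Fin N → Bool
  eqb a b = ⌊ a ≟F b ⌋

  eqb-complete : {a b : Fin N} → a ≡ b → eqb a b ≡ true
  eqb-complete {a} {b} e with a ≟F b
  ... | yes _ = refl
  ... | no ne = ⊥-elim (ne e)

  eqb-false : {a b : Fin N} → a ≢ b → eqb a b ≡ false
  eqb-false {a} {b} ne with a ≟F b
  ... | yes e = ⊥-elim (ne e)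
  ... | no _  = refl

  eqb-sound : {a b : Fin N} → eqb a b ≡ true → a ≡ b
  eqb-sound {a} {b} t with a ≟F b
  eqb-sound {a} {b} () | no _
  ... | yes e = e

  eqb-sym : (a b : Fin N) → eqb a b ≡ eqb b a
  eqb-sym a b with a ≟F b | b ≟F a
  ... | yes _ | yes _ = refl
  ... | no _  | no _  = refl
  ... | yes e | no ne = ⊥-elim (ne (sym e))
  ... | no ne | yes e = ⊥-elim (ne (sym e))

  sameEdge-sym : (u v : Fin N) (e : Fin N × Fin N) → sameEdge u v e ≡ sameEdge v u e
  sameEdge-sym u v (x , y) = ∨-comm (eqb x u ∧ eqb y v) (eqb x v ∧ eqb y u)

  sameEdge-swap : (u v : Fin N) (e : Fin N × Fin N) → sameEdge u v (Prod.swap e) ≡ sameEdge u v e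
  sameEdge-swap u v (x , y) = trans (∨-comm (eqb y u ∧ eqb x v) (eqb y v ∧ eqb x u))
    (cong₂ _∨_ (∧-comm (eqb y v) (eqb x u)) (∧-comm (eqb y u) (eqb x v)))

  sameEdge-avoid₁ : {u v x y : Fin N} → x ≢ u → x ≢ v → sameEdge u v (x , y) ≡ false
  sameEdge-avoid₁ {u} {v} {x} {y} x≢u x≢v rewrite eqb-false x≢u | eqb-false x≢v = refl

  sameEdge-avoid₂ : {u v x y : Fin N} → y ≢ u → y ≢ v → sameEdge u v (x , y) ≡ false
  sameEdge-avoid₂ {u} {v} {x} {y} y≢u y≢v rewrite eqb-false y≢u | eqb-false y≢v =
    cong₂ _∨_ (∧-zeroʳ (eqb x u)) (∧-zeroʳ (eqb x v))

  sameEdge-avoidˡ : {u v x y : Fin N} → x ≢ u → y ≢ u → sameEdge u v (x , y) ≡ false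
  sameEdge-avoidˡ {u} {v} {x} {y} x≢u y≢u rewrite eqb-false x≢u | eqb-false y≢u = ∧-zeroʳ (eqb x v)

  sameEdge-avoidʳ : {u v x y : Fin N} → x ≢ v → y ≢ v → sameEdge u v (x , y) ≡ false
  sameEdge-avoidʳ {u} {v} {x} {y} x≢v y≢v rewrite eqb-false x≢v | eqb-false y≢v =
    trans (∨-identityʳ (eqb x u ∧ false)) (∧-zeroʳ (eqb x u))

  sameEdge-from : (u y z : Fin N) → y ≢ u → sameEdge u y (u , z) ≡ eqb z y
  sameEdge-from u y z y≢u rewrite eqb-complete {u} refl | eqb-false (λ e → y≢u (sym e)) =
    ∨-identityʳ (eqb z y)

  sameEdge-to : (u y z : Fin N) → y ≢ u → sameEdge u y (z , u) ≡ eqb z y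
  sameEdge-to u y z y≢u rewrite eqb-complete {u} refl | eqb-false (λ e → y≢u (sym e))
    with eqb z u | eqb z y
  ... | true  | true  = refl
  ... | true  | false = refl
  ... | false | true  = refl
  ... | false | false = refl

Edge-sym : (Γ : Graph) {a b : V Γ} → Edge Γ a b → Edge Γ b a
Edge-sym Γ {a} {b} e = trans (adj-sym Γ b a) e

Edge⇒≢ : (Γ : Graph) {a b : V Γ} → Edge Γ a b → a ≢ b
Edge⇒≢ Γ {a} e refl with trans (sym e) (adj-irr Γ a)
... | ()

module _ (Γ : Graph) (D : Orientation Γ) where

  reverse-evenly : ∀ L → All (λ e → Edge Γ (proj₁ e) (proj₂ e)) (cycEdges L) → 2 ∣ length L →
    2 ∣ forwardCount D (cycEdges L) → 2 ∣ forwardCount D (cycEdges (reverse L))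
  reverse-evenly L edges even-length even-forward =
    subst (2 ∣_) (sym backward) (∣m+n∣m⇒∣n (subst (2 ∣_) (sym total) even-length) even-forward)
    where
    fwd : V Γ × V Γ → Bool
    fwd e = dir D (proj₁ e) (proj₂ e)
    backward : forwardCount D (cycEdges (reverse L)) ≡ countᵇ (λ e → not (fwd e)) (cycEdges L)
    backward = trans (countᵇ-↭ fwd (cycEdges-reverse L)) (trans (countᵇ-map fwd Prod.swap (cycEdges L))
      (countᵇ-cong-on (All.map (λ {e} uv → dir-exact D (proj₁ e) (proj₂ e) uv) edges)))
    total : countᵇ fwd (cycEdges L) + countᵇ (λ e → not (fwd e)) (cycEdges L) ≡ length L
    total = trans (countᵇ-complement fwd (cycEdges L)) (length-cycEdges L)

-- Undoing the contraction of an odd cycle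

module Uncontract (G H : Graph) (C : Cycle G) (C-odd : OddCycle C) (φ : V G → V H) (c : V H)
  (φ-C : ∀ u → u ∈ verts C → φ u ≡ c)
  (φ-out : ∀ u → u ∉ verts C → φ u ≢ c)
  (φ-injective : ∀ u w → u ∉ verts C → w ∉ verts C → φ u ≡ φ w → u ≡ w)
  (φ-onto : ∀ x → Σ (V G) λ u → φ u ≡ x)
  (adj⇔ : ∀ x y → Edge H x y ⇔
    (x ≢ y × Σ (V G) λ u → Σ (V G) λ w → φ u ≡ x × φ w ≡ y × Edge G u w))
  (F′ : OneFactor H) (D′ : Orientation H) where

  open import Data.List.Membership.DecPropositional (_≟F_ {n G}) using (_∈?_)
  open import Data.List.Membership.DecPropositional (_≟F_ {n H}) using () renaming (_∈?_ to _∈?ᴴ_)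

  ψ : V H → V G
  ψ x = proj₁ (φ-onto x)

  φ∘ψ : ∀ x → φ (ψ x) ≡ x
  φ∘ψ x = proj₂ (φ-onto x)

  ψ-injective : ∀ {x y} → ψ x ≡ ψ y → x ≡ y
  ψ-injective {x} {y} e = trans (sym (φ∘ψ x)) (trans (cong φ e) (φ∘ψ y))

  φ≡c⇒∈C : ∀ u → φ u ≡ c → u ∈ verts C
  φ≡c⇒∈C u e with u ∈? verts C
  ... | yes u∈ = u∈
  ... | no u∉  = ⊥-elim (φ-out u u∉ e)

  ψ∉C : ∀ x → x ≢ c → ψ x ∉ verts C
  ψ∉C x x≢c m = x≢c (trans (sym (φ∘ψ x)) (φ-C (ψ x) m))

  ψ-unique : ∀ {x u} → x ≢ c → φ u ≡ x → u ≡ ψ x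
  ψ-unique {x} {u} x≢c e =
    φ-injective u (ψ x) (λ m → x≢c (trans (sym e) (φ-C u m))) (ψ∉C x x≢c) (trans e (sym (φ∘ψ x)))

  Edge-ψ : ∀ {x y} → x ≢ c → y ≢ c → Edge H x y → Edge G (ψ x) (ψ y)
  Edge-ψ {x} {y} x≢c y≢c e with Equivalence.to (adj⇔ x y) e
  ... | _ , u , w , refl , refl , uw rewrite sym (ψ-unique x≢c refl) | sym (ψ-unique y≢c refl) = uw

  Edge-φ : ∀ {a b} → a ∉ verts C → b ∉ verts C → Edge G a b → Edge H (φ a) (φ b)
  Edge-φ {a} {b} a∉ b∉ e = Equivalence.from (adj⇔ (φ a) (φ b))
    ((λ q → Edge⇒≢ G e (φ-injective a b a∉ b∉ q)) , a , b , refl , refl , e)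

  Edge-φ-C : ∀ {a b} → a ∈ verts C → b ∉ verts C → Edge G a b → Edge H c (φ b)
  Edge-φ-C {a} {b} a∈ b∉ e = Equivalence.from (adj⇔ c (φ b))
    ((λ q → φ-out b b∉ (sym q)) , a , b , φ-C a a∈ , refl , e)

  Edge-c⇒≢c : ∀ {y} → Edge H c y → y ≢ c
  Edge-c⇒≢c e refl = Edge⇒≢ H e refl

  -- For a neighbour y of c, a vertex of C adjacent to ψ y (junk otherwise).
  attach′ : (y : V H) (β : Bool) → adj H c y ≡ β → V G
  attach′ y true  e = proj₁ (proj₂ (Equivalence.to (adj⇔ c y) e))
  attach′ y false e = ψ y

  attach : V H → V G
  attach y = attach′ y (adj H c y) refl

  attach-spec : ∀ y → Edge H c y → attach y ∈ verts C × Edge G (attach y) (ψ y)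
  attach-spec y = spec (adj H c y) refl
    where
    spec : (β : Bool) (e : adj H c y ≡ β) → β ≡ true →
      attach′ y β e ∈ verts C × Edge G (attach′ y β e) (ψ y)
    spec true e _ with Equivalence.to (adj⇔ c y) e
    ... | c≢y , u , w , φu , refl , uw = φ≡c⇒∈C u φu , subst (Edge G u) (ψ-unique (λ q → c≢y (sym q)) refl) uw

  p : V H
  p = proj₁ (perfect F′ c)

  inF′-cp : inF F′ c p ≡ true
  inF′-cp = proj₁ (proj₂ (perfect F′ c))

  inF′-c : ∀ y → inF F′ c y ≡ eqb y p
  inF′-c y with inF F′ c y in cy | y ≟F p
  ... | true  | yes _    = refl
  ... | true  | no y≢p   = ⊥-elim (y≢p (proj₂ (proj₂ (perfect F′ c)) y cy))
  ... | false | no _     = refl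
  ... | false | yes refl with trans (sym cy) inF′-cp
  ...   | ()

  Edge-cp : Edge H c p
  Edge-cp = inF-E F′ c p inF′-cp

  u₀ : V G
  u₀ = attach p

  u₀∈C : u₀ ∈ verts C
  u₀∈C = proj₁ (attach-spec p Edge-cp)

  private
    split-at-u₀ : Σ (List (V G)) λ xs → Σ (List (V G)) λ ys → verts C ≡ xs ++ u₀ ∷ ys
    split-at-u₀ = ∈-∃++ u₀∈C

  -- the vertices of C other than u₀, in cyclic order, so that  Q = C rotated to end at u₀
  P Q : List (V G)
  P = proj₁ (proj₂ split-at-u₀) ++ proj₁ split-at-u₀
  Q = P ++ [ u₀ ]

  C↭Q : verts C ↭ Q
  C↭Q = subst (_↭ Q) (sym (proj₂ (proj₂ split-at-u₀)))
    (↭-trans (rotate-↭ (proj₁ split-at-u₀) u₀ (proj₁ (proj₂ split-at-u₀))) (++-comm [ u₀ ] P))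

  cycEdges-C↭Q : cycEdges (verts C) ↭ cycEdges Q
  cycEdges-C↭Q = subst (λ L → cycEdges L ↭ cycEdges Q) (sym (proj₂ (proj₂ split-at-u₀)))
    (↭-trans (cycEdges-rotate (proj₁ split-at-u₀) (u₀ ∷ proj₁ (proj₂ split-at-u₀))) (cycEdges-rotate [ u₀ ] P))

  ∈Q⇒∈C : ∀ {a} → a ∈ Q → a ∈ verts C
  ∈Q⇒∈C = ∈-resp-↭ (↭-sym C↭Q)

  ∈C⇒∈Q : ∀ {a} → a ∈ verts C → a ∈ Q
  ∈C⇒∈Q = ∈-resp-↭ C↭Q

  ∉Q⇒∉C : ∀ {a} → a ∉ Q → a ∉ verts C
  ∉Q⇒∉C a∉ m = a∉ (∈C⇒∈Q m)

  Q-unique : Unique Q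
  Q-unique = Unique-resp-↭ C↭Q (distinct C)

  EdgeG : V G × V G → Set
  EdgeG e = Edge G (proj₁ e) (proj₂ e)

  Q-edges : All EdgeG (cycEdges Q)
  Q-edges = All-resp-↭ cycEdges-C↭Q (adjacent C)

  K : ℕ
  K = length P

  length-Q : length Q ≡ suc K
  length-Q = trans (length-++ P) (+-comm K 1)

  length-C : length (verts C) ≡ suc K
  length-C = trans (↭-length C↭Q) length-Q

  K-even : ∃ λ m → K ≡ m + m
  K-even with even-or-odd K
  ... | inj₁ (_ , m , K≡) = m , K≡
  ... | inj₂ (_ , t , K≡) = ⊥-elim (C-odd (divides (suc t) (begin
      length (verts C)  ≡⟨ length-C ⟩
      suc K             ≡⟨ cong suc K≡ ⟩
      suc (suc (t + t)) ≡⟨ solve 1 (λ t → con 2 :+ (t :+ t) := (con 1 :+ t) :* con 2) refl t ⟩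
      suc t * 2         ∎)))
    where open ≡-Reasoning

  evenᵇ-K : evenᵇ K ≡ true
  evenᵇ-K = subst (λ z → evenᵇ z ≡ true) (sym (proj₂ K-even)) (evenᵇ-double (proj₁ K-even))

  2≤K : 2 ≤ K
  2≤K = ≤-pred (subst (3 ≤_) length-C (len≥3 C))

  idx : V G → ℕ
  idx a = position _≟F_ a Q

  at : ℕ → V G
  at k = lookupOr Q k u₀

  at-K : at K ≡ u₀
  at-K = lookupOr-++ P u₀ [] u₀

  idx< : ∀ {a} → a ∈ Q → idx a < suc K
  idx< {a} a∈ = subst (idx a <_) length-Q (position< _≟F_ a Q a∈)

  idx-at : ∀ k → k < suc K → idx (at k) ≡ k
  idx-at k k< = position-lookupOr _≟F_ Q k u₀ Q-unique (subst (k <_) (sym length-Q) k<)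

  at∈Q : ∀ k → k < suc K → at k ∈ Q
  at∈Q k k< = lookupOr∈ Q k u₀ (subst (k <_) (sym length-Q) k<)

  at-idx : ∀ {a} → a ∈ Q → at (idx a) ≡ a
  at-idx {a} = lookupOr-position _≟F_ a u₀ Q

  idx-injective : ∀ {a b} → a ∈ Q → b ∈ Q → idx a ≡ idx b → a ≡ b
  idx-injective {a} {b} = position-injective _≟F_ a b Q

  u₀∈Q : u₀ ∈ Q
  u₀∈Q = ∈C⇒∈Q u₀∈C

  idx-u₀ : idx u₀ ≡ K
  idx-u₀ = subst (λ z → idx z ≡ K) at-K (idx-at K ≤-refl)

  φ-outQ : ∀ {a} → a ∉ Q → φ a ≢ c
  φ-outQ {a} a∉ = φ-out a (∉Q⇒∉C a∉)

  ψ∉Q : ∀ x → x ≢ c → ψ x ∉ Q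
  ψ∉Q x x≢c m = ψ∉C x x≢c (∈Q⇒∈C m)

  ψ∘φ : ∀ {a} → a ∉ Q → ψ (φ a) ≡ a
  ψ∘φ {a} a∉ = sym (ψ-unique (φ-outQ a∉) refl)

  ψ≢∈Q : ∀ {x a} → x ≢ c → a ∈ Q → ψ x ≢ a
  ψ≢∈Q x≢c a∈ e = ψ∉Q _ x≢c (subst (_∈ Q) (sym e) a∈)

  ∈Q≢∉Q : ∀ {x a} → x ∈ Q → a ∉ Q → x ≢ a
  ∈Q≢∉Q x∈ a∉ e = a∉ (subst (_∈ Q) e x∈)

  Q-path-edges : All EdgeG (pathEdges Q) × Edge G u₀ (at 0)
  Q-path-edges = split P refl
    where
    split : (P′ : List (V G)) → P′ ≡ P → All EdgeG (pathEdges (P′ ++ [ u₀ ])) × Edge G u₀ (lookupOr (P′ ++ [ u₀ ]) 0 u₀)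
    split []       P≡ = ⊥-elim (<⇒≱ 2≤K (subst (λ L → length L ≤ 1) P≡ z≤n))
    split (x ∷ xs) P≡ = ++⁻ˡ (pathEdges (x ∷ xs ++ [ u₀ ])) edges ,
      subst (λ z → Edge G z x) (final-snoc x xs u₀) (All.head (++⁻ʳ (pathEdges (x ∷ xs ++ [ u₀ ])) edges))
      where
      edges : All EdgeG (consec x (xs ++ [ u₀ ]) ++ [ (final x (xs ++ [ u₀ ]) , x) ])
      edges = subst (All EdgeG) (consec-snoc x (xs ++ [ u₀ ]) x)
        (subst (λ L → All EdgeG (cycEdges (L ++ [ u₀ ]))) (sym P≡) Q-edges)

  edge-at : ∀ k → suc k < suc K → Edge G (at k) (at (suc k))
  edge-at k k< = pathEdges-lookupOr Q k u₀ (subst (suc k <_) (sym length-Q) k<) (proj₁ Q-path-edges)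

  -- The 1-factor and the orientation of G

  sides : {R : Set} → V G → V G → R → R → R → R → R
  sides a b rCC rCO rOC rOO with a ∈? Q | b ∈? Q
  ... | yes _ | yes _ = rCC
  ... | yes _ | no _  = rCO
  ... | no _  | yes _ = rOC
  ... | no _  | no _  = rOO

  module _ {R : Set} {a b : V G} {rCC rCO rOC rOO : R} where

    sides-CC : a ∈ Q → b ∈ Q → sides a b rCC rCO rOC rOO ≡ rCC
    sides-CC a∈ b∈ with a ∈? Q | b ∈? Q
    ... | yes _  | yes _  = refl
    ... | no a∉  | _      = ⊥-elim (a∉ a∈)
    ... | yes _  | no b∉  = ⊥-elim (b∉ b∈)

    sides-CO : a ∈ Q → b ∉ Q → sides a b rCC rCO rOC rOO ≡ rCO
    sides-CO a∈ b∉ with a ∈? Q | b ∈? Q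
    ... | yes _  | no _   = refl
    ... | no a∉  | _      = ⊥-elim (a∉ a∈)
    ... | yes _  | yes b∈ = ⊥-elim (b∉ b∈)

    sides-OC : a ∉ Q → b ∈ Q → sides a b rCC rCO rOC rOO ≡ rOC
    sides-OC a∉ b∈ with a ∈? Q | b ∈? Q
    ... | no _   | yes _  = refl
    ... | yes a∈ | _      = ⊥-elim (a∉ a∈)
    ... | no _   | no b∉  = ⊥-elim (b∉ b∈)

    sides-OO : a ∉ Q → b ∉ Q → sides a b rCC rCO rOC rOO ≡ rOO
    sides-OO a∉ b∉ with a ∈? Q | b ∈? Q
    ... | no _   | no _   = refl
    ... | yes a∈ | _      = ⊥-elim (a∉ a∈)
    ... | no _   | yes b∈ = ⊥-elim (b∉ b∈)

  by-membership : ∀ {ℓ} {R : Set ℓ} a → (a ∈ Q → R) → (a ∉ Q → R) → R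
  by-membership a f g with a ∈? Q
  ... | yes a∈ = f a∈
  ... | no a∉  = g a∉

  inF-G : V G → V G → Bool
  inF-G a b = sides a b (idx b ≡ᵇ partner (idx a)) (eqb a u₀ ∧ eqb (φ b) p)
                        (eqb b u₀ ∧ eqb (φ a) p) (inF F′ (φ a) (φ b))

  inF-G-sym : ∀ a b → inF-G a b ≡ inF-G b a
  inF-G-sym a b = by-membership a
    (λ a∈ → by-membership b
      (λ b∈ → trans (sides-CC a∈ b∈) (trans (≡ᵇpartner-sym (idx a) (idx b)) (sym (sides-CC b∈ a∈))))
      (λ b∉ → trans (sides-CO a∈ b∉) (sym (sides-OC b∉ a∈))))
    (λ a∉ → by-membership b
      (λ b∈ → trans (sides-OC a∉ b∈) (sym (sides-CO b∈ a∉)))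
      (λ b∉ → trans (sides-OO a∉ b∉) (trans (inF-sym F′ (φ a) (φ b)) (sym (sides-OO b∉ a∉)))))

  ∧-true : ∀ {x y} → (x ∧ y) ≡ true → x ≡ true × y ≡ true
  ∧-true {true} {true} _ = refl , refl

  Edge-subst : ∀ {x x′ y y′} → x ≡ x′ → y ≡ y′ → Edge G x y → Edge G x′ y′
  Edge-subst refl refl e = e

  Edge-u₀ψp : Edge G u₀ (ψ p)
  Edge-u₀ψp = proj₂ (attach-spec p Edge-cp)

  inF-G-E : ∀ a b → inF-G a b ≡ true → Edge G a b
  inF-G-E a b t = by-membership a
    (λ a∈ → by-membership b (λ b∈ → CC a∈ b∈ (≡ᵇ-sound (trans (sym (sides-CC a∈ b∈)) t))) (λ b∉ → CO a∈ b∉))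
    (λ a∉ → by-membership b (λ b∈ → Edge-sym G (OC a∉ b∈)) (λ b∉ → OO a∉ b∉))
    where
    CC : a ∈ Q → b ∈ Q → idx b ≡ partner (idx a) → Edge G a b
    CC a∈ b∈ matched with even-or-odd (idx a)
    ... | inj₁ (even , _) = Edge-subst (at-idx a∈) (trans (cong at (sym next)) (at-idx b∈))
                              (edge-at (idx a) (subst (_< suc K) next (idx< b∈)))
      where
      next : idx b ≡ suc (idx a)
      next = trans matched (partner-even (idx a) even)
    ... | inj₂ (odd , _)  = Edge-sym G (Edge-subst (at-idx b∈) (trans (cong at prev) (at-idx a∈))
                              (edge-at (idx b) (subst (_< suc K) (sym prev) (idx< a∈))))
      where
      prev : suc (idx b) ≡ idx a
      prev = trans (cong suc matched) (partner-odd (idx a) odd)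
    CO : a ∈ Q → b ∉ Q → Edge G a b
    CO a∈ b∉ with ∧-true (trans (sym (sides-CO a∈ b∉)) t)
    ... | a≡u₀ , φb≡p = Edge-subst (sym (eqb-sound a≡u₀))
                          (trans (cong ψ (sym (eqb-sound φb≡p))) (ψ∘φ b∉)) Edge-u₀ψp
    OC : a ∉ Q → b ∈ Q → Edge G b a
    OC a∉ b∈ with ∧-true (trans (sym (sides-OC a∉ b∈)) t)
    ... | b≡u₀ , φa≡p = Edge-subst (sym (eqb-sound b≡u₀))
                          (trans (cong ψ (sym (eqb-sound φa≡p))) (ψ∘φ a∉)) Edge-u₀ψp
    OO : a ∉ Q → b ∉ Q → Edge G a b
    OO a∉ b∉ = Edge-subst (ψ∘φ a∉) (ψ∘φ b∉)
      (Edge-ψ (φ-outQ a∉) (φ-outQ b∉) (inF-E F′ (φ a) (φ b) (trans (sym (sides-OO a∉ b∉)) t)))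

  partner<K : ∀ i → i < K → partner i < suc K
  partner<K i i<K with even-or-odd i
  ... | inj₁ (even , _) = subst (_< suc K) (sym (partner-even i even)) (s≤s i<K)
  ... | inj₂ (odd , _)  = subst (_≤ suc K) (sym (partner-odd i odd)) (≤-trans (<⇒≤ i<K) (n≤1+n K))

  idx<K : ∀ {a} → a ∈ Q → a ≢ u₀ → idx a < K
  idx<K a∈ a≢u₀ = ≤∧≢⇒< (≤-pred (idx< a∈)) (λ e → a≢u₀ (idx-injective a∈ u₀∈Q (trans e (sym idx-u₀))))

  ∧-intro : ∀ {x y} → x ≡ true → y ≡ true → (x ∧ y) ≡ true
  ∧-intro refl refl = refl

  UniqueMate : V G → Set
  UniqueMate a = Σ (V G) λ w → inF-G a w ≡ true × (∀ w′ → inF-G a w′ ≡ true → w′ ≡ w)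

  mate-u₀ : UniqueMate u₀
  mate-u₀ = ψ p , trans (sides-CO u₀∈Q (ψ∉Q p (Edge-c⇒≢c Edge-cp)))
                        (∧-intro (eqb-complete refl) (eqb-complete (φ∘ψ p))) ,
    λ w′ t → by-membership w′
      (λ w′∈ → ⊥-elim (n≮n (suc K) (subst (_< suc K) (past-end w′∈ t) (idx< w′∈))))
      (λ w′∉ → trans (sym (ψ∘φ w′∉)) (cong ψ (eqb-sound (proj₂ (∧-true (trans (sym (sides-CO u₀∈Q w′∉)) t))))))
    where
    past-end : ∀ {w′} → w′ ∈ Q → inF-G u₀ w′ ≡ true → idx w′ ≡ suc K
    past-end w′∈ t = trans (≡ᵇ-sound (trans (sym (sides-CC u₀∈Q w′∈)) t))
                           (trans (cong partner idx-u₀) (partner-even K evenᵇ-K))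

  mate-inner : ∀ a → a ∈ Q → a ≢ u₀ → UniqueMate a
  mate-inner a a∈ a≢u₀ = at (partner (idx a)) ,
    trans (sides-CC a∈ (at∈Q _ bound))
          (subst (λ z → (z ≡ᵇ partner (idx a)) ≡ true) (sym (idx-at _ bound)) (≡ᵇ-refl (partner (idx a)))) ,
    λ w′ t → by-membership w′
      (λ w′∈ → idx-injective w′∈ (at∈Q _ bound)
        (trans (≡ᵇ-sound (trans (sym (sides-CC a∈ w′∈)) t)) (sym (idx-at _ bound))))
      (λ w′∉ → ⊥-elim (a≢u₀ (eqb-sound (proj₁ (∧-true (trans (sym (sides-CO a∈ w′∉)) t))))))
    where
    bound : partner (idx a) < suc K
    bound = partner<K (idx a) (idx<K a∈ a≢u₀)

  mate-C : ∀ a → a ∈ Q → Dec (a ≡ u₀) → UniqueMate a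
  mate-C a a∈ (yes refl) = mate-u₀
  mate-C a a∈ (no a≢u₀)  = mate-inner a a∈ a≢u₀

  mate-out : ∀ a → a ∉ Q → UniqueMate a
  mate-out a a∉ with perfect F′ (φ a)
  ... | y , φa-y , unique with y ≟F c
  ...   | yes refl = u₀ , trans (sides-OC a∉ u₀∈Q) (∧-intro (eqb-complete refl) φa≡p) ,
      λ w′ t → by-membership w′
        (λ w′∈ → eqb-sound (proj₁ (∧-true (trans (sym (sides-OC a∉ w′∈)) t))))
        (λ w′∉ → ⊥-elim (φ-outQ w′∉ (unique (φ w′) (trans (sym (sides-OO a∉ w′∉)) t))))
    where
    φa≡p : eqb (φ a) p ≡ true
    φa≡p = trans (sym (inF′-c (φ a))) (trans (inF-sym F′ c (φ a)) φa-y)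
  ...   | no y≢c = ψ y , trans (sides-OO a∉ (ψ∉Q y y≢c)) (subst (λ z → inF F′ (φ a) z ≡ true) (sym (φ∘ψ y)) φa-y) ,
      λ w′ t → by-membership w′
        (λ w′∈ → ⊥-elim (y≢c (sym (unique c (trans (inF-sym F′ (φ a) c)
          (trans (inF′-c (φ a)) (proj₂ (∧-true (trans (sym (sides-OC a∉ w′∈)) t)))))))))
        (λ w′∉ → ψ-unique y≢c (unique (φ w′) (trans (sym (sides-OO a∉ w′∉)) t)))

  F : OneFactor G
  F = record
    { inF     = inF-G
    ; inF-sym = inF-G-sym
    ; inF-E   = inF-G-E
    ; perfect = λ a → by-membership a (λ a∈ → mate-C a a∈ (a ≟F u₀)) (mate-out a)
    }

  dir-sides : V G → V G → Bool
  dir-sides a b = sides a b (cyclicᵇ K (idx a) (idx b)) (dir D′ c (φ b)) (dir D′ (φ a) c) (dir D′ (φ a) (φ b))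

  dir-G : V G → V G → Bool
  dir-G a b = adj G a b ∧ dir-sides a b

  dir-G-edge : ∀ {a b} → Edge G a b → dir-G a b ≡ dir-sides a b
  dir-G-edge {a} {b} e = cong (_∧ dir-sides a b) e

  dir-sides-exact : ∀ a b → Edge G a b → dir-sides b a ≡ not (dir-sides a b)
  dir-sides-exact a b e = by-membership a
    (λ a∈ → by-membership b
      (λ b∈ → trans (sides-CC b∈ a∈) (trans (cyclicᵇ-flip K (idx a) (idx b) (λ q → Edge⇒≢ G e (idx-injective a∈ b∈ q)))
                (cong not (sym (sides-CC a∈ b∈)))))
      (λ b∉ → trans (sides-OC b∉ a∈) (trans (dir-exact D′ c (φ b) (Edge-φ-C (∈Q⇒∈C a∈) (∉Q⇒∉C b∉) e))
                (cong not (sym (sides-CO a∈ b∉))))))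
    (λ a∉ → by-membership b
      (λ b∈ → trans (sides-CO b∈ a∉) (trans (sym (not-involutive _))
                (cong not (trans (sym (dir-exact D′ c (φ a) (Edge-φ-C (∈Q⇒∈C b∈) (∉Q⇒∉C a∉) (Edge-sym G e))))
                  (sym (sides-OC a∉ b∈))))))
      (λ b∉ → trans (sides-OO b∉ a∉) (trans (dir-exact D′ (φ a) (φ b) (Edge-φ (∉Q⇒∉C a∉) (∉Q⇒∉C b∉) e))
                (cong not (sym (sides-OO a∉ b∉))))))

  D : Orientation G
  D = record
    { dir       = dir-G
    ; dir-edge  = λ a b t → proj₁ (∧-true t)
    ; dir-exact = λ a b e → trans (dir-G-edge (Edge-sym G e))
                              (trans (dir-sides-exact a b e) (cong not (sym (dir-G-edge e))))
    }

  -- Paths inside C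

  FP : V G × V G → Bool
  FP e = inF-G (proj₁ e) (proj₂ e)

  DP : V G × V G → Bool
  DP e = dir-G (proj₁ e) (proj₂ e)

  inF-at : ∀ i l → i < suc K → l < suc K → inF-G (at i) (at l) ≡ (l ≡ᵇ partner i)
  inF-at i l i< l< = trans (sides-CC (at∈Q i i<) (at∈Q l l<))
    (cong₂ (λ x y → x ≡ᵇ partner y) (idx-at l l<) (idx-at i i<))

  dir-at : ∀ i l → i < suc K → l < suc K → Edge G (at i) (at l) → dir-G (at i) (at l) ≡ cyclicᵇ K i l
  dir-at i l i< l< e = trans (dir-G-edge e) (trans (sides-CC (at∈Q i i<) (at∈Q l l<))
    (cong₂ (cyclicᵇ K) (idx-at i i<) (idx-at l l<)))

  inF-up : ∀ k → suc k < suc K → inF-G (at k) (at (suc k)) ≡ evenᵇ k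
  inF-up k k< = trans (inF-at k (suc k) (≤-trans (n≤1+n (suc k)) k<) k<) (suc≡ᵇpartner k)

  inF-down : ∀ k → suc k < suc K → inF-G (at (suc k)) (at k) ≡ evenᵇ k
  inF-down k k< = trans (inF-at (suc k) k k< (≤-trans (n≤1+n (suc k)) k<)) (≡ᵇpartner-suc k)

  dir-up : ∀ k → suc k < suc K → dir-G (at k) (at (suc k)) ≡ true
  dir-up k k< = trans (dir-at k (suc k) (≤-trans (n≤1+n (suc k)) k<) k< (edge-at k k<)) (cyclicᵇ-up k 2≤K (≤-pred k<))

  dir-down : ∀ k → suc k < K → dir-G (at (suc k)) (at k) ≡ false
  dir-down k k<K = trans (dir-at (suc k) k k< (≤-trans (n≤1+n (suc k)) k<) (Edge-sym G (edge-at k k<))) (cyclicᵇ-down k k<K)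
    where
    k< : suc k < suc K
    k< = s≤s (<⇒≤ k<K)

  Edge-at0-atK : Edge G (at 0) (at K)
  Edge-at0-atK = Edge-sym G (subst (λ z → Edge G z (at 0)) (sym at-K) (proj₂ Q-path-edges))

  inF-wrap : inF-G (at 0) (at K) ≡ false
  inF-wrap = trans (inF-at 0 K (s≤s z≤n) ≤-refl) (≡ᵇ-false (<⇒≢ 2≤K ∘ sym))

  dir-wrap : dir-G (at 0) (at K) ≡ false
  dir-wrap = trans (dir-at 0 K (s≤s z≤n) ≤-refl Edge-at0-atK) (cyclicᵇ-wrap 2≤K)

  record IsSegment (w : V G) (ss : List (V G)) : Set where
    field
      final≡  : final w ss ≡ u₀
      inQ     : All (_∈ Q) (w ∷ ss)
      unique  : Unique (w ∷ ss)
      edges   : All EdgeG (consec w ss)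
      half    : ℕ
      length≡ : length ss ≡ half + half
      F-count : countᵇ FP (consec w ss) ≡ half
      D-even  : 2 ∣ countᵇ DP (consec w ss)

  Unique-at : ∀ {ks} → All (_< suc K) ks → Unique ks → Unique (map at ks)
  Unique-at = Unique-map-on at (λ {x} {y} x< y< e → trans (sym (idx-at x x<)) (trans (cong idx e) (idx-at y y<)))

  segment-even : ∀ a → a + a ≤ K → IsSegment (at (a + a)) (map at (stepsUp (a + a) (K ∸ (a + a))))
  segment-even a j≤K = record
    { final≡  = trans (final-map at j (stepsUp j d)) (trans (cong at (trans (final-stepsUp j d) j+d≡K)) at-K)
    ; inQ     = map⁺ (All.map (λ (_ , k≤) → at∈Q _ (bound k≤)) (stepsUp-bounds j d))
    ; unique  = Unique-at (All.map (λ (_ , k≤) → bound k≤) (stepsUp-bounds j d)) (Unique-stepsUp j d)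
    ; edges   = subst (All EdgeG) (sym (consec-map at j (stepsUp j d)))
        (map⁺ (All.map (λ {e} (l≡ , l≤) → step-edge e l≡ l≤) (consec-stepsUp j d)))
    ; half    = t
    ; length≡ = trans (length-map at (stepsUp j d)) (trans (length-stepsUp j d) d≡)
    ; F-count = trans (countᵇ-consec-map FP at j (stepsUp j d))
        (trans (countᵇ-cong-on (All.map (λ {e} (l≡ , l≤) → step-F e l≡ l≤) (consec-stepsUp j d)))
        (subst (λ z → countᵇ (λ e → evenᵇ (proj₁ e)) (consec j (stepsUp j z)) ≡ t) (sym d≡)
          (countᵇ-even-stepsUp t j (evenᵇ-double a))))
    ; D-even  = subst (2 ∣_) (sym forward) (2∣double t)
    }
    where
    j d t : ℕ
    j = a + a
    d = K ∸ j
    t = proj₁ K-even ∸ a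
    j+d≡K : j + d ≡ K
    j+d≡K = m+[n∸m]≡n j≤K
    d≡ : d ≡ t + t
    d≡ = trans (cong (_∸ j) (proj₂ K-even))
      (double-∸ (proj₁ K-even) a (double-≤-cancel a (proj₁ K-even) (subst (j ≤_) (proj₂ K-even) j≤K)))
    bound : ∀ {k} → k ≤ j + d → k < suc K
    bound k≤ = s≤s (≤-trans k≤ (≤-reflexive j+d≡K))
    step-edge : ∀ e → proj₂ e ≡ suc (proj₁ e) → proj₂ e ≤ j + d → EdgeG (at (proj₁ e) , at (proj₂ e))
    step-edge (k , _) refl l≤ = edge-at k (bound l≤)
    step-F : ∀ e → proj₂ e ≡ suc (proj₁ e) → proj₂ e ≤ j + d → FP (at (proj₁ e) , at (proj₂ e)) ≡ evenᵇ (proj₁ e)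
    step-F (k , _) refl l≤ = inF-up k (bound l≤)
    step-D : ∀ e → proj₂ e ≡ suc (proj₁ e) → proj₂ e ≤ j + d → DP (at (proj₁ e) , at (proj₂ e)) ≡ true
    step-D (k , _) refl l≤ = dir-up k (bound l≤)
    forward : countᵇ DP (consec (at j) (map at (stepsUp j d))) ≡ t + t
    forward = trans (countᵇ-consec-map DP at j (stepsUp j d))
      (trans (countᵇ-all (All.map (λ {e} (l≡ , l≤) → step-D e l≡ l≤) (consec-stepsUp j d)))
      (trans (length-consec j (stepsUp j d)) (trans (length-stepsUp j d) d≡)))

  segment-odd : ∀ t → suc (t + t) < K → IsSegment (at (suc (t + t))) (map at (downFrom (suc (t + t)) ++ [ K ]))
  segment-odd t j<K = record
    { final≡  = trans (final-map at j (downFrom j ++ [ K ])) (trans (cong at (final-snoc j (downFrom j) K)) at-K)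
    ; inQ     = map⁺ (++⁺ (All.map (λ k≤ → at∈Q _ (bound k≤)) (downFrom-bounds j)) (at∈Q K ≤-refl ∷ []))
    ; unique  = Unique-at (++⁺ (All.map bound (downFrom-bounds j)) (≤-refl ∷ []))
        (Unique-snoc (All.map (λ k≤ → <⇒≢ (≤-<-trans k≤ j<K)) (downFrom-bounds j)) (Unique-downFrom j))
    ; edges   = subst (All EdgeG) (sym along)
        (map⁺ (++⁺ (All.map (λ {e} (k≡ , k≤) → step-edge e k≡ k≤) (consec-downFrom j)) (Edge-at0-atK ∷ [])))
    ; half    = suc t
    ; length≡ = trans (length-map at (downFrom j ++ [ K ])) (trans (length-++ (downFrom j))
        (trans (cong (_+ 1) (length-downFrom j)) (trans (+-comm j 1) (cong suc (sym (+-suc t t))))))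
    ; F-count = trans (cong (countᵇ FP) along)
        (trans (countᵇ-map FP (at ×ᶠ_) (consec j (downFrom j) ++ [ (0 , K) ]))
        (trans (countᵇ-++ _ (consec j (downFrom j)) [ (0 , K) ])
        (trans (cong₂ _+_ (countᵇ-cong-on (All.map (λ {e} (k≡ , k≤) → step-F e k≡ k≤) (consec-downFrom j)))
                          (cong (λ b → bit b + 0) inF-wrap))
        (trans (+-identityʳ _) (countᵇ-even-downFrom t)))))
    ; D-even  = subst (2 ∣_) (sym forward) (2 ∣0)
    }
    where
    j : ℕ
    j = suc (t + t)
    bound : ∀ {k} → k ≤ j → k < suc K
    bound k≤ = s≤s (<⇒≤ (≤-<-trans k≤ j<K))
    along : consec (at j) (map at (downFrom j ++ [ K ])) ≡ map (at ×ᶠ_) (consec j (downFrom j) ++ [ (0 , K) ])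
    along = trans (consec-map at j (downFrom j ++ [ K ])) (cong (map (at ×ᶠ_))
      (trans (consec-snoc j (downFrom j) K) (cong (λ z → consec j (downFrom j) ++ [ (z , K) ]) (final-downFrom j))))
    step-edge : ∀ e → proj₁ e ≡ suc (proj₂ e) → proj₁ e ≤ j → EdgeG (at (proj₁ e) , at (proj₂ e))
    step-edge (_ , k) refl k≤ = Edge-sym G (edge-at k (bound k≤))
    step-F : ∀ e → proj₁ e ≡ suc (proj₂ e) → proj₁ e ≤ j → FP (at (proj₁ e) , at (proj₂ e)) ≡ evenᵇ (proj₂ e)
    step-F (_ , k) refl k≤ = inF-down k (bound k≤)
    step-D : ∀ e → proj₁ e ≡ suc (proj₂ e) → proj₁ e ≤ j → DP (at (proj₁ e) , at (proj₂ e)) ≡ false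
    step-D (_ , k) refl k≤ = dir-down k (≤-<-trans k≤ j<K)
    forward : countᵇ DP (consec (at j) (map at (downFrom j ++ [ K ]))) ≡ 0
    forward = trans (cong (countᵇ DP) along) (trans (countᵇ-map DP (at ×ᶠ_) (consec j (downFrom j) ++ [ (0 , K) ]))
      (countᵇ-none (++⁺ (All.map (λ {e} (k≡ , k≤) → step-D e k≡ k≤) (consec-downFrom j))
        (dir-wrap ∷ []))))

  -- the positions after j on the path from position j to position K (that is, to u₀)
  -- which starts with a matching edge
  toEnd : ℕ → List ℕ
  toEnd j = if evenᵇ j then stepsUp j (K ∸ j) else downFrom j ++ [ K ]

  segment-at : ∀ j → j < suc K → IsSegment (at j) (map at (toEnd j))
  segment-at j j< with even-or-odd j
  ... | inj₁ (_ , a , refl) rewrite evenᵇ-double a     = segment-even a (≤-pred j<)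
  ... | inj₂ (_ , t , refl) rewrite evenᵇ-suc-double t =
    segment-odd t (≤∧≢⇒< (≤-pred j<) (λ j≡K → true≢false (trans (sym evenᵇ-K) (trans (cong evenᵇ (sym j≡K)) (evenᵇ-suc-double t)))))
    where true≢false : true ≢ false
          true≢false ()

  segment : V G → List (V G)
  segment w = map at (toEnd (idx w))

  segment-spec : ∀ w → w ∈ Q → IsSegment w (segment w)
  segment-spec w w∈ = subst (λ h → IsSegment h (segment w)) (at-idx w∈) (segment-at (idx w) (idx< w∈))

  FP′ : V H × V H → Bool
  FP′ e = inF F′ (proj₁ e) (proj₂ e)

  DP′ : V H × V H → Bool
  DP′ e = dir D′ (proj₁ e) (proj₂ e)

  EdgeH : V H × V H → Set
  EdgeH e = Edge H (proj₁ e) (proj₂ e)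

  inF′-next : ∀ {x y z} → inF F′ x y ≡ true → x ≢ z → inF F′ y z ≡ false
  inF′-next {x} {y} {z} xy x≢z with inF F′ y z in yz
  ... | false = refl
  ... | true  = ⊥-elim (x≢z (trans (mate x (trans (inF-sym F′ y x) xy)) (sym (mate z yz))))
    where
    mate : ∀ v → inF F′ y v ≡ true → v ≡ proj₁ (perfect F′ y)
    mate = proj₂ (proj₂ (perfect F′ y))

  -- no two consecutive edges of a path lie in the 1-factor
  matched-on-path : ∀ x xs → Unique (x ∷ xs) →
    countᵇ FP′ (consec x xs) + countᵇ FP′ (consec x xs) ≤ suc (length xs)
  matched-on-path x []           _ = z≤n
  matched-on-path x (y ∷ [])     _ with inF F′ x y
  ... | true  = s≤s (s≤s z≤n)
  ... | false = z≤n
  matched-on-path x (y ∷ z ∷ zs) (x∉ ∷ y∉ ∷ u′) =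
    extend (inF F′ x y) refl (matched-on-path y (z ∷ zs) (y∉ ∷ u′)) (matched-on-path z zs u′)
    where
    m : ℕ
    m = countᵇ FP′ (consec z zs)
    extend : (b : Bool) → inF F′ x y ≡ b →
      countᵇ FP′ (consec y (z ∷ zs)) + countᵇ FP′ (consec y (z ∷ zs)) ≤ suc (length (z ∷ zs)) →
      m + m ≤ suc (length zs) →
      countᵇ FP′ (consec x (y ∷ z ∷ zs)) + countᵇ FP′ (consec x (y ∷ z ∷ zs)) ≤ suc (length (y ∷ z ∷ zs))
    extend false xy from-y _ rewrite xy = ≤-trans from-y (n≤1+n _)
    extend true  xy _ from-z rewrite xy | inF′-next {x} {y} {z} xy (All.lookup x∉ (there (here refl))) =
      s≤s (subst (_≤ suc (suc (length zs))) (sym (+-suc m m)) (s≤s from-z))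

  -- Otherwise neither edge of Z at c is matched, and the path  z, zs…  is too short
  -- to carry the |Z|/2 matched edges of Z.
  leaves-c-towards-p : ∀ {Z z zs} → FAlternating F′ Z → cycEdges (verts Z) ↭ cycEdges (c ∷ z ∷ zs) →
    Unique (c ∷ z ∷ zs) → z ≡ p ⊎ final z zs ≡ p
  leaves-c-towards-p {Z} {z} {zs} alt E↭ (_ ∷ u) with z ≟F p | final z zs ≟F p
  ... | yes z≡p | _          = inj₁ z≡p
  ... | no _    | yes last≡p = inj₂ last≡p
  ... | no z≢p  | no last≢p  = ⊥-elim (n≮n _ (≤-trans (s≤s (subst (_≤ suc (length zs)) twice (matched-on-path z zs u))) ≤-refl))
    where
    X : ℕ
    X = countᵇ FP′ (consec z zs)
    F-on-Z : FonC F′ Z ≡ X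
    F-on-Z = begin
        FonC F′ Z
      ≡⟨ countᵇ-↭ FP′ E↭ ⟩
        countᵇ FP′ ((c , z) ∷ consec z (zs ++ [ c ]))
      ≡⟨ cong (λ L → countᵇ FP′ ((c , z) ∷ L)) (consec-snoc z zs c) ⟩
        bit (inF F′ c z) + countᵇ FP′ (consec z zs ++ [ (final z zs , c) ])
      ≡⟨ cong (bit (inF F′ c z) +_) (countᵇ-++ FP′ (consec z zs) _) ⟩
        bit (inF F′ c z) + (X + (bit (inF F′ (final z zs) c) + 0))
      ≡⟨ cong₂ (λ a b → bit a + (X + (bit b + 0)))
           (trans (inF′-c z) (eqb-false z≢p))
           (trans (inF-sym F′ _ c) (trans (inF′-c _) (eqb-false last≢p))) ⟩
        X + 0
      ≡⟨ +-identityʳ X ⟩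
        X ∎
      where open ≡-Reasoning
    twice : X + X ≡ suc (suc (length zs))
    twice = begin
        X + X                       ≡⟨ cong (X +_) (+-identityʳ X) ⟨
        2 * X                       ≡⟨ cong (2 *_) F-on-Z ⟨
        2 * FonC F′ Z               ≡⟨ alt ⟨
        length (verts Z)            ≡⟨ length-cycEdges (verts Z) ⟨
        length (cycEdges (verts Z)) ≡⟨ ↭-length E↭ ⟩
        length (cycEdges (c ∷ z ∷ zs)) ≡⟨ length-cycEdges (c ∷ z ∷ zs) ⟩
        suc (suc (length zs))       ∎
      where open ≡-Reasoning

  -- Z, traversed in one of its two directions, runs  c, p, rest…
  Traversal : Cycle H → List (V H) → Set
  Traversal Z rest = cycEdges (verts Z) ↭ cycEdges (c ∷ p ∷ rest)
                   ⊎ cycEdges (reverse (verts Z)) ↭ cycEdges (c ∷ p ∷ rest)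

  record Through (Z : Cycle H) : Set where
    field
      rest      : List (V H)
      vertices↭ : verts Z ↭ c ∷ p ∷ rest
      edges↭    : Traversal Z rest

  rotate-at-c : ∀ {L} xs ys → L ≡ xs ++ c ∷ ys → ∀ {zs} → ys ++ xs ≡ zs →
    L ↭ c ∷ zs × cycEdges L ↭ cycEdges (c ∷ zs)
  rotate-at-c xs ys refl refl = rotate-↭ xs c ys , cycEdges-rotate xs (c ∷ ys)

  through : (Z : Cycle H) → FAlternating F′ Z → c ∈ verts Z → Through Z
  through Z alt c∈ with ∈-∃++ c∈
  ... | xs , ys , Z≡ with ys ++ xs in yx
  ...   | [] = ⊥-elim (<⇒≱ (len≥3 Z) (≤-trans (≤-reflexive (↭-length (proj₁ (rotate-at-c xs ys Z≡ yx)))) (s≤s z≤n)))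
  ...   | z ∷ zs with rotate-at-c xs ys Z≡ yx
  ...     | Z↭ , E↭ with leaves-c-towards-p {Z} alt E↭ (Unique-resp-↭ Z↭ (distinct Z))
  ...       | inj₁ refl = record { rest = zs ; vertices↭ = Z↭ ; edges↭ = inj₁ E↭ }
  ...       | inj₂ last≡p with rotate-at-c (reverse ys) (reverse xs) reverse-Z reverse-yx
    where
    reverse-Z : reverse (verts Z) ≡ reverse ys ++ c ∷ reverse xs
    reverse-Z = trans (cong reverse Z≡) (trans (reverse-++ xs (c ∷ ys))
                  (trans (cong (_++ reverse xs) (unfold-reverse c ys)) (++-assoc (reverse ys) [ c ] (reverse xs))))
    reverse-yx : reverse xs ++ reverse ys ≡ p ∷ reverseTail z zs
    reverse-yx = trans (sym (reverse-++ ys xs)) (trans (cong reverse yx)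
                   (trans (reverse-∷ z zs) (cong (_∷ reverseTail z zs) last≡p)))
  ...         | rZ↭ , rE↭ = record
    { rest = reverseTail z zs ; vertices↭ = ↭-trans (↭-sym (↭-reverse (verts Z))) rZ↭ ; edges↭ = inj₂ rE↭ }

  -- Lifting alternating cycles

  inF-attach : ∀ y → Edge H c y → inF-G (attach y) (ψ y) ≡ inF F′ c y
  inF-attach y cy = trans (sides-CO (∈C⇒∈Q (proj₁ (attach-spec y cy))) (ψ∉Q y (Edge-c⇒≢c cy)))
    (trans (cong (λ z → eqb (attach y) u₀ ∧ eqb z p) (φ∘ψ y)) (link (y ≟F p)))
    where
    link : Dec (y ≡ p) → (eqb (attach y) u₀ ∧ eqb y p) ≡ inF F′ c y
    link (yes refl) = trans (cong₂ _∧_ (eqb-complete {a = u₀} refl) (eqb-complete {a = p} refl)) (sym inF′-cp)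
    link (no y≢p)   = trans (cong (eqb (attach y) u₀ ∧_) (eqb-false y≢p))
                        (trans (∧-zeroʳ _) (sym (trans (inF′-c y) (eqb-false y≢p))))

  eqb-ψ : ∀ {x a} → x ≢ c → a ∉ Q → eqb (ψ x) a ≡ eqb x (φ a)
  eqb-ψ {x} {a} x≢c a∉ with ψ x ≟F a | x ≟F φ a
  ... | yes _ | yes _ = refl
  ... | no _  | no _  = refl
  ... | yes e | no ne = ⊥-elim (ne (trans (sym (φ∘ψ x)) (cong φ e)))
  ... | no ne | yes e = ⊥-elim (ne (trans (cong ψ e) (ψ∘φ a∉)))

  sameEdge-ψ : ∀ {a b} e → Both (_≢ c) e → a ∉ Q → b ∉ Q → sameEdge a b (ψ ×ᶠ e) ≡ sameEdge (φ a) (φ b) e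
  sameEdge-ψ (u , v) (u≢c , v≢c) a∉ b∉ =
    cong₂ _∨_ (cong₂ _∧_ (eqb-ψ u≢c a∉) (eqb-ψ v≢c b∉)) (cong₂ _∧_ (eqb-ψ u≢c b∉) (eqb-ψ v≢c a∉))

  FP-ψ : ∀ e → Both (_≢ c) e → FP (ψ ×ᶠ e) ≡ FP′ e
  FP-ψ (u , v) (u≢c , v≢c) = trans (sides-OO (ψ∉Q u u≢c) (ψ∉Q v v≢c)) (cong₂ (inF F′) (φ∘ψ u) (φ∘ψ v))

  DP-ψ : ∀ e → EdgeG (ψ ×ᶠ e) → Both (_≢ c) e → DP (ψ ×ᶠ e) ≡ DP′ e
  DP-ψ (u , v) uv (u≢c , v≢c) = trans (dir-G-edge uv)
    (trans (sides-OO (ψ∉Q u u≢c) (ψ∉Q v v≢c)) (cong₂ (dir D′) (φ∘ψ u) (φ∘ψ v)))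

  inSegment : V G → V G → V H → Bool
  inSegment a b y = 0 <ᵇ countᵇ (sameEdge a b) (consec (attach y) (segment (attach y)))

  module Lift-through {Z : Cycle H} (T : Through Z) where
    open Through T

    y : V H
    y = final p rest

    mid : List (V H × V H)
    mid = consec p rest

    count-Z : ∀ q → (∀ e → q (Prod.swap e) ≡ q e) →
      countᵇ q (cycEdges (verts Z)) ≡ bit (q (c , p)) + (countᵇ q mid + (bit (q (y , c)) + 0))
    count-Z q q-sym = trans (via edges↭) (cong (bit (q (c , p)) +_)
      (trans (cong (countᵇ q) (consec-snoc p rest c)) (countᵇ-++ q mid [ (y , c) ])))
      where
      via : Traversal Z rest → countᵇ q (cycEdges (verts Z)) ≡ countᵇ q (cycEdges (c ∷ p ∷ rest))
      via (inj₁ E↭) = countᵇ-↭ q E↭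
      via (inj₂ E↭) = trans (sym (trans (countᵇ-↭ q (cycEdges-reverse (verts Z)))
        (trans (countᵇ-map q Prod.swap (cycEdges (verts Z))) (countᵇ-cong (cycEdges (verts Z)) q-sym))))
        (countᵇ-↭ q E↭)

    forward-even : EvenlyOriented D′ Z →
      2 ∣ bit (DP′ (c , p)) + (countᵇ DP′ mid + (bit (DP′ (y , c)) + 0))
    forward-even (even , reverse-even) = subst (2 ∣_) split (via edges↭)
      where
      split : countᵇ DP′ (cycEdges (c ∷ p ∷ rest)) ≡
              bit (DP′ (c , p)) + (countᵇ DP′ mid + (bit (DP′ (y , c)) + 0))
      split = trans (cong (countᵇ DP′) (cong ((c , p) ∷_) (consec-snoc p rest c)))
                    (cong (bit (DP′ (c , p)) +_) (countᵇ-++ DP′ mid [ (y , c) ]))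
      via : Traversal Z rest → 2 ∣ countᵇ DP′ (cycEdges (c ∷ p ∷ rest))
      via (inj₁ E↭) = subst (2 ∣_) (countᵇ-↭ DP′ E↭) even
      via (inj₂ E↭) = subst (2 ∣_) (countᵇ-↭ DP′ E↭) reverse-even

    edges-rot : All EdgeH (cycEdges (c ∷ p ∷ rest))
    edges-rot = via edges↭
      where
      via : Traversal Z rest → All EdgeH (cycEdges (c ∷ p ∷ rest))
      via (inj₁ E↭) = All-resp-↭ E↭ (adjacent Z)
      via (inj₂ E↭) = All-resp-↭ E↭ (All-resp-↭ (↭-sym (cycEdges-reverse (verts Z)))
        (map⁺ (All.map (Edge-sym H) (adjacent Z))))

    edges-mid : All EdgeH mid
    edges-mid = ++⁻ˡ mid (All.tail (subst (All EdgeH) (cong ((c , p) ∷_) (consec-snoc p rest c)) edges-rot))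

    Edge-cy : Edge H c y
    Edge-cy = Edge-sym H (All.head (++⁻ʳ mid (All.tail (subst (All EdgeH) (cong ((c , p) ∷_) (consec-snoc p rest c)) edges-rot))))

    length-Z : length (verts Z) ≡ suc (suc (length rest))
    length-Z = ↭-length vertices↭

    rest-nonempty : 1 ≤ length rest
    rest-nonempty = ≤-pred (≤-pred (subst (3 ≤_) length-Z (len≥3 Z)))

    unique-rot : Unique (c ∷ p ∷ rest)
    unique-rot = Unique-resp-↭ vertices↭ (distinct Z)

    not-c : All (_≢ c) (p ∷ rest)
    not-c = All.map (λ c≢ e → c≢ (sym e)) (AllPairs.head unique-rot)

    y∈rest : y ∈ rest
    y∈rest = last∈ p rest rest-nonempty
      where
      last∈ : ∀ x xs → 1 ≤ length xs → final x xs ∈ xs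
      last∈ x (z ∷ [])     _ = here refl
      last∈ x (z ∷ z′ ∷ zs) _ = there (last∈ z (z′ ∷ zs) (s≤s z≤n))

    p≢y : p ≢ y
    p≢y = All.lookup (AllPairs.head (AllPairs.tail unique-rot)) y∈rest

    y≢c : y ≢ c
    y≢c = All.lookup not-c (there y∈rest)

    h : V G
    h = attach y

    h∈Q : h ∈ Q
    h∈Q = ∈C⇒∈Q (proj₁ (attach-spec y Edge-cy))

    open IsSegment (segment-spec h h∈Q)

    segE : List (V G × V G)
    segE = consec h (segment h)

    vertices : List (V G)
    vertices = h ∷ (segment h ++ map ψ (p ∷ rest))

    cycEdges-vertices : cycEdges vertices ≡ segE ++ (u₀ , ψ p) ∷ (map (ψ ×ᶠ_) mid ++ [ (ψ y , h) ])
    cycEdges-vertices = begin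
        consec h ((segment h ++ map ψ (p ∷ rest)) ++ [ h ])
      ≡⟨ cong (consec h) (++-assoc (segment h) (map ψ (p ∷ rest)) [ h ]) ⟩
        consec h (segment h ++ ψ p ∷ (map ψ rest ++ [ h ]))
      ≡⟨ consec-++ h (segment h) (ψ p) (map ψ rest ++ [ h ]) ⟩
        segE ++ (final h (segment h) , ψ p) ∷ consec (ψ p) (map ψ rest ++ [ h ])
      ≡⟨ cong₂ (λ x L → segE ++ (x , ψ p) ∷ L) final≡ (consec-snoc (ψ p) (map ψ rest) h) ⟩
        segE ++ (u₀ , ψ p) ∷ (consec (ψ p) (map ψ rest) ++ [ (final (ψ p) (map ψ rest) , h) ])
      ≡⟨ cong₂ (λ L x → segE ++ (u₀ , ψ p) ∷ (L ++ [ (x , h) ])) (consec-map ψ p rest) (final-map ψ p rest) ⟩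
        segE ++ (u₀ , ψ p) ∷ (map (ψ ×ᶠ_) mid ++ [ (ψ y , h) ]) ∎
      where open ≡-Reasoning

    count-vertices : ∀ q → countᵇ q (cycEdges vertices) ≡
      countᵇ q segE + (bit (q (u₀ , ψ p)) + (countᵇ (λ e → q (ψ ×ᶠ e)) mid + (bit (q (ψ y , h)) + 0)))
    count-vertices q = trans (cong (countᵇ q) cycEdges-vertices) (trans (countᵇ-++ q segE _)
      (cong (λ k → countᵇ q segE + (bit (q (u₀ , ψ p)) + k))
        (trans (countᵇ-++ q (map (ψ ×ᶠ_) mid) _) (cong (_+ (bit (q (ψ y , h)) + 0)) (countᵇ-map q (ψ ×ᶠ_) mid)))))

    mid-not-c : All (Both (_≢ c)) mid
    mid-not-c = All-consec p rest not-c

    edges-ψmid : All (λ e → EdgeG (ψ ×ᶠ e)) mid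
    edges-ψmid = All.zipWith (λ (uv , (u≢c , v≢c)) → Edge-ψ u≢c v≢c uv) (edges-mid , mid-not-c)

    edges-vertices : All EdgeG (cycEdges vertices)
    edges-vertices = subst (All EdgeG) (sym cycEdges-vertices) (++⁺ edges
      (Edge-u₀ψp ∷ ++⁺ (map⁺ edges-ψmid) (Edge-sym G (proj₂ (attach-spec y Edge-cy)) ∷ [])))

    unique-vertices : Unique vertices
    unique-vertices = Unique.++⁺ unique (Unique.map⁺ ψ-injective (AllPairs.tail unique-rot)) disjoint
      where
      disjoint : ∀ {v} → v ∈ h ∷ segment h × v ∈ map ψ (p ∷ rest) → ⊥
      disjoint (v∈seg , v∈ψ) with ∈-map⁻ ψ v∈ψ
      ... | x , x∈ , refl = ψ∉Q x (All.lookup not-c x∈) (All.lookup inQ v∈seg)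

    length-vertices : length vertices ≡ suc (length (segment h) + suc (length rest))
    length-vertices = cong suc (trans (length-++ (segment h)) (cong (λ k → length (segment h) + suc k) (length-map ψ rest)))

    cycle : Cycle G
    cycle = record
      { verts    = vertices
      ; len≥3    = subst (3 ≤_) (sym length-vertices)
                     (s≤s (≤-trans (s≤s rest-nonempty) (m≤n+m (suc (length rest)) (length (segment h)))))
      ; distinct = unique-vertices
      ; adjacent = edges-vertices
      }

    FonC-cycle : FonC F cycle ≡ half + FonC F′ Z
    FonC-cycle = trans (count-vertices FP) (cong₂ _+_ F-count (sym (trans (count-Z FP′ (λ (u , v) → inF-sym F′ v u))
      (cong₂ _+_ (cong bit (sym (inF-attach p Edge-cp)))
        (cong₂ (λ x y → x + (y + 0)) (countᵇ-cong-on (All.map (λ {e} ne → sym (FP-ψ e ne)) mid-not-c))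
          (cong bit (trans (inF-sym F′ y c) (trans (sym (inF-attach y Edge-cy)) (inF-G-sym h (ψ y))))))))))

    alternating : FAlternating F′ Z → FAlternating F cycle
    alternating alt = begin
        length vertices                            ≡⟨ length-vertices ⟩
        suc (length (segment h) + suc (length rest)) ≡⟨ cong (λ k → suc (k + suc (length rest))) length≡ ⟩
        suc ((half + half) + suc (length rest))    ≡⟨ move-suc half (length rest) ⟩
        (half + half) + suc (suc (length rest))    ≡⟨ cong ((half + half) +_) (trans (sym length-Z) alt) ⟩
        (half + half) + 2 * FonC F′ Z              ≡⟨ regroup half (FonC F′ Z) ⟩
        2 * (half + FonC F′ Z)                     ≡⟨ cong (2 *_) FonC-cycle ⟨
        2 * FonC F cycle                           ∎
      where
      open ≡-Reasoning
      move-suc : ∀ a s → suc ((a + a) + suc s) ≡ (a + a) + suc (suc s)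
      move-suc = solve 2 (λ a s → con 1 :+ ((a :+ a) :+ (con 1 :+ s)) := (a :+ a) :+ (con 2 :+ s)) refl
      regroup : ∀ a f → (a + a) + 2 * f ≡ 2 * (a + f)
      regroup = solve 2 (λ a f → (a :+ a) :+ (con 2 :* f) := con 2 :* (a :+ f)) refl

    forwardCount-cycle : forwardCount D (cycEdges vertices) ≡
      countᵇ DP segE + (bit (DP′ (c , p)) + (countᵇ DP′ mid + (bit (DP′ (y , c)) + 0)))
    forwardCount-cycle = trans (count-vertices DP) (cong (countᵇ DP segE +_)
      (cong₂ _+_ (cong bit first) (cong₂ (λ x y → x + (bit y + 0))
        (countᵇ-cong-on (All.zipWith (λ {e} (uv , ne) → DP-ψ e uv ne) (edges-ψmid , mid-not-c))) last)))
      where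
      first : DP (u₀ , ψ p) ≡ DP′ (c , p)
      first = trans (dir-G-edge Edge-u₀ψp)
        (trans (sides-CO u₀∈Q (ψ∉Q p (Edge-c⇒≢c Edge-cp))) (cong (dir D′ c) (φ∘ψ p)))
      last : DP (ψ y , h) ≡ DP′ (y , c)
      last = trans (dir-G-edge (Edge-sym G (proj₂ (attach-spec y Edge-cy))))
        (trans (sides-OC (ψ∉Q y y≢c) h∈Q) (cong (λ z → dir D′ z c) (φ∘ψ y)))

    evenly : FAlternating F′ Z → EvenlyOriented D′ Z → EvenlyOriented D cycle
    evenly alt even = even-forward ,
      reverse-evenly G D vertices edges-vertices
        (subst (2 ∣_) (sym (alternating alt)) (divides (FonC F cycle) (*-comm 2 (FonC F cycle)))) even-forward
      where
      even-forward : 2 ∣ forwardCount D (cycEdges vertices)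
      even-forward = subst (2 ∣_) (sym forwardCount-cycle) (∣m∣n⇒∣m+n D-even (forward-even even))

    segE-in-Q : All (Both (_∈ Q)) segE
    segE-in-Q = All-consec h (segment h) inQ

    edgeOn-Z : ∀ u v → edgeOn u v Z ≡
      (0 <ᵇ (bit (sameEdge u v (c , p)) + (countᵇ (sameEdge u v) mid + (bit (sameEdge u v (y , c)) + 0))))
    edgeOn-Z u v = cong (0 <ᵇ_) (count-Z (sameEdge u v) (sameEdge-swap u v))

    edgeOn-cycle : ∀ a b → edgeOn a b cycle ≡ (0 <ᵇ (countᵇ (sameEdge a b) segE + (bit (sameEdge a b (u₀ , ψ p))
      + (countᵇ (λ e → sameEdge a b (ψ ×ᶠ e)) mid + (bit (sameEdge a b (ψ y , h)) + 0)))))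
    edgeOn-cycle a b = cong (0 <ᵇ_) (count-vertices (sameEdge a b))

    edgeOn-OO : ∀ {a b} → a ∉ Q → b ∉ Q → edgeOn a b cycle ≡ edgeOn (φ a) (φ b) Z
    edgeOn-OO {a} {b} a∉ b∉ rewrite edgeOn-cycle a b | edgeOn-Z (φ a) (φ b)
      | countᵇ-none {p = sameEdge a b} (All.map (λ (x∈ , _) → sameEdge-avoid₁ (∈Q≢∉Q x∈ a∉) (∈Q≢∉Q x∈ b∉)) segE-in-Q)
      | sameEdge-avoid₁ {u = a} {v = b} {y = ψ p} (∈Q≢∉Q u₀∈Q a∉) (∈Q≢∉Q u₀∈Q b∉)
      | sameEdge-avoid₂ {u = a} {v = b} {x = ψ y} (∈Q≢∉Q h∈Q a∉) (∈Q≢∉Q h∈Q b∉)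
      | sameEdge-avoid₁ {u = φ a} {v = φ b} {y = p} (φ-outQ a∉ ∘ sym) (φ-outQ b∉ ∘ sym)
      | sameEdge-avoid₂ {u = φ a} {v = φ b} {x = y} (φ-outQ a∉ ∘ sym) (φ-outQ b∉ ∘ sym)
      | countᵇ-cong-on {p = λ e → sameEdge a b (ψ ×ᶠ e)} {q = sameEdge (φ a) (φ b)}
          (All.map (λ {e} ne → sameEdge-ψ e ne a∉ b∉) mid-not-c) = refl

    edgeOn-c : ∀ y′ → y′ ≢ c → edgeOn c y′ Z ≡ (eqb p y′ ∨ eqb y y′)
    edgeOn-c y′ y′≢c rewrite edgeOn-Z c y′ | sameEdge-from c y′ p y′≢c | sameEdge-to c y′ y y′≢c
      | countᵇ-none {p = sameEdge c y′} (All.map (λ (u≢c , v≢c) → sameEdge-avoidˡ u≢c v≢c) mid-not-c) =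
      0<ᵇbits (eqb p y′) (eqb y y′)

    edgeOn-CO : ∀ {a b} → a ∈ Q → b ∉ Q → edgeOn a b cycle ≡ (eqb a (attach (φ b)) ∧ edgeOn c (φ b) Z)
    edgeOn-CO {a} {b} a∈ b∉ = begin
        edgeOn a b cycle
      ≡⟨ edgeOn-cycle a b ⟩
        _
      ≡⟨ cong (0 <ᵇ_) only-ends ⟩
        (0 <ᵇ (bit (eqb u₀ a ∧ eqb p (φ b)) + (bit (eqb y (φ b) ∧ eqb h a) + 0)))
      ≡⟨ 0<ᵇbits (eqb u₀ a ∧ eqb p (φ b)) (eqb y (φ b) ∧ eqb h a) ⟩
        (eqb u₀ a ∧ eqb p (φ b)) ∨ (eqb y (φ b) ∧ eqb h a)
      ≡⟨ ∧∨-merge (eqb a (attach (φ b))) (eqb u₀ a) (eqb h a) (eqb p (φ b)) (eqb y (φ b))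
           (λ t → trans (cong (λ z → eqb (attach z) a) (eqb-sound t)) (eqb-sym _ a))
           (λ t → trans (cong (λ z → eqb (attach z) a) (eqb-sound t)) (eqb-sym _ a)) ⟩
        eqb a (attach (φ b)) ∧ (eqb p (φ b) ∨ eqb y (φ b))
      ≡⟨ cong (eqb a (attach (φ b)) ∧_) (edgeOn-c (φ b) (φ-outQ b∉)) ⟨
        eqb a (attach (φ b)) ∧ edgeOn c (φ b) Z ∎
      where
      open ≡-Reasoning
      only-ends : countᵇ (sameEdge a b) segE + (bit (sameEdge a b (u₀ , ψ p))
          + (countᵇ (λ e → sameEdge a b (ψ ×ᶠ e)) mid + (bit (sameEdge a b (ψ y , h)) + 0)))
        ≡ bit (eqb u₀ a ∧ eqb p (φ b)) + (bit (eqb y (φ b) ∧ eqb h a) + 0)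
      only-ends rewrite countᵇ-none {p = sameEdge a b} {xs = segE}
          (All.map (λ (u∈ , v∈) → sameEdge-avoidʳ (∈Q≢∉Q u∈ b∉) (∈Q≢∉Q v∈ b∉)) segE-in-Q)
        | countᵇ-none {p = λ e → sameEdge a b (ψ ×ᶠ e)}
          (All.map (λ (u≢c , v≢c) → sameEdge-avoidˡ (ψ≢∈Q u≢c a∈) (ψ≢∈Q v≢c a∈)) mid-not-c)
        | eqb-ψ {p} {b} (Edge-c⇒≢c Edge-cp) b∉ | eqb-false (∈Q≢∉Q u₀∈Q b∉)
        | eqb-false (ψ≢∈Q y≢c a∈) | eqb-ψ {y} {b} y≢c b∉
        | ∨-identityʳ (eqb u₀ a ∧ eqb p (φ b)) = refl

    edgeOn-CC : ∀ {a b} → a ∈ Q → b ∈ Q → edgeOn a b cycle ≡ inSegment a b y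
    edgeOn-CC {a} {b} a∈ b∈ rewrite edgeOn-cycle a b
      | sameEdge-avoid₂ {u = a} {v = b} {x = u₀} (ψ≢∈Q (Edge-c⇒≢c Edge-cp) a∈) (ψ≢∈Q (Edge-c⇒≢c Edge-cp) b∈)
      | sameEdge-avoid₁ {u = a} {v = b} {y = h} (ψ≢∈Q y≢c a∈) (ψ≢∈Q y≢c b∈)
      | countᵇ-none {p = λ e → sameEdge a b (ψ ×ᶠ e)} {xs = mid}
          (All.map (λ (u≢c , _) → sameEdge-avoid₁ (ψ≢∈Q u≢c a∈) (ψ≢∈Q u≢c b∈)) mid-not-c)
      | +-identityʳ (countᵇ (sameEdge a b) segE) = refl

  module Lift-avoiding {Z : Cycle H} (c∉Z : c ∉ verts Z) where

    not-c : All (Both (_≢ c)) (cycEdges (verts Z))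
    not-c = All-cycEdges (verts Z) (All.tabulate (λ z∈ z≡c → c∉Z (subst (_∈ verts Z) z≡c z∈)))

    count-vertices : ∀ q → countᵇ q (cycEdges (map ψ (verts Z))) ≡ countᵇ (λ e → q (ψ ×ᶠ e)) (cycEdges (verts Z))
    count-vertices q = trans (cong (countᵇ q) (cycEdges-map ψ (verts Z))) (countᵇ-map q (ψ ×ᶠ_) (cycEdges (verts Z)))

    edges-ψ : All (λ e → EdgeG (ψ ×ᶠ e)) (cycEdges (verts Z))
    edges-ψ = All.zipWith (λ (uv , (u≢c , v≢c)) → Edge-ψ u≢c v≢c uv) (adjacent Z , not-c)

    cycle : Cycle G
    cycle = record
      { verts    = map ψ (verts Z)
      ; len≥3    = subst (3 ≤_) (sym (length-map ψ (verts Z))) (len≥3 Z)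
      ; distinct = Unique.map⁺ ψ-injective (distinct Z)
      ; adjacent = subst (All EdgeG) (sym (cycEdges-map ψ (verts Z))) (map⁺ edges-ψ)
      }

    alternating : FAlternating F′ Z → FAlternating F cycle
    alternating alt = trans (length-map ψ (verts Z)) (trans alt (cong (2 *_) (sym (trans (count-vertices FP)
      (countᵇ-cong-on (All.map (λ {e} ne → FP-ψ e ne) not-c))))))

    evenly : FAlternating F′ Z → EvenlyOriented D′ Z → EvenlyOriented D cycle
    evenly alt (even , _) = even-forward ,
      reverse-evenly G D (verts cycle) (adjacent cycle)
        (subst (2 ∣_) (sym (alternating alt)) (divides (FonC F cycle) (*-comm 2 (FonC F cycle)))) even-forward
      where
      even-forward : 2 ∣ forwardCount D (cycEdges (verts cycle))
      even-forward = subst (2 ∣_) (sym (trans (count-vertices DP)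
        (countᵇ-cong-on (All.zipWith (λ {e} (uv , ne) → DP-ψ e uv ne) (edges-ψ , not-c))))) even

    edgeOn-cycle : ∀ a b → edgeOn a b cycle ≡ (0 <ᵇ countᵇ (λ e → sameEdge a b (ψ ×ᶠ e)) (cycEdges (verts Z)))
    edgeOn-cycle a b = cong (0 <ᵇ_) (count-vertices (sameEdge a b))

    edgeOn-OO : ∀ {a b} → a ∉ Q → b ∉ Q → edgeOn a b cycle ≡ edgeOn (φ a) (φ b) Z
    edgeOn-OO {a} {b} a∉ b∉ = trans (edgeOn-cycle a b)
      (cong (0 <ᵇ_) (countᵇ-cong-on (All.map (λ {e} ne → sameEdge-ψ e ne a∉ b∉) not-c)))

    edgeOn-C : ∀ {a} b → a ∈ Q → edgeOn a b cycle ≡ false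
    edgeOn-C {a} b a∈ = trans (edgeOn-cycle a b) (cong (0 <ᵇ_) (countᵇ-none {p = λ e → sameEdge a b (ψ ×ᶠ e)}
      (All.map (λ (u≢c , v≢c) → sameEdge-avoidˡ (ψ≢∈Q u≢c a∈) (ψ≢∈Q v≢c a∈)) not-c)))

    edgeOn-c : ∀ y → edgeOn c y Z ≡ false
    edgeOn-c y = cong (0 <ᵇ_) (countᵇ-none {p = sameEdge c y}
      (All.map (λ (u≢c , v≢c) → sameEdge-avoidˡ u≢c v≢c) not-c))

  lift : (Z : Cycle H) → FAlternating F′ Z → Cycle G
  lift Z alt with c ∈?ᴴ verts Z
  ... | yes c∈ = Lift-through.cycle (through Z alt c∈)
  ... | no c∉  = Lift-avoiding.cycle {Z} c∉

  -- the neighbour of c other than p on Z, if Z passes through c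
  other : (Z : Cycle H) → FAlternating F′ Z → Maybe (V H)
  other Z alt with c ∈?ᴴ verts Z
  ... | yes c∈ = just (Lift-through.y (through Z alt c∈))
  ... | no _   = nothing

  module _ (Z : Cycle H) (alt : FAlternating F′ Z) where

    lift-alternating : FAlternating F (lift Z alt)
    lift-alternating with c ∈?ᴴ verts Z
    ... | yes c∈ = Lift-through.alternating (through Z alt c∈) alt
    ... | no c∉  = Lift-avoiding.alternating {Z} c∉ alt

    lift-evenly : EvenlyOriented D′ Z → EvenlyOriented D (lift Z alt)
    lift-evenly with c ∈?ᴴ verts Z
    ... | yes c∈ = Lift-through.evenly (through Z alt c∈) alt
    ... | no c∉  = Lift-avoiding.evenly {Z} c∉ alt

    lift-edgeOn-OO : ∀ {a b} → a ∉ Q → b ∉ Q → edgeOn a b (lift Z alt) ≡ edgeOn (φ a) (φ b) Z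
    lift-edgeOn-OO a∉ b∉ with c ∈?ᴴ verts Z
    ... | yes c∈ = Lift-through.edgeOn-OO (through Z alt c∈) a∉ b∉
    ... | no c∉  = Lift-avoiding.edgeOn-OO {Z} c∉ a∉ b∉

    lift-edgeOn-CO : ∀ {a b} → a ∈ Q → b ∉ Q → edgeOn a b (lift Z alt) ≡ (eqb a (attach (φ b)) ∧ edgeOn c (φ b) Z)
    lift-edgeOn-CO {a} {b} a∈ b∉ with c ∈?ᴴ verts Z
    ... | yes c∈ = Lift-through.edgeOn-CO (through Z alt c∈) a∈ b∉
    ... | no c∉  = trans (Lift-avoiding.edgeOn-C {Z} c∉ b a∈)
      (sym (trans (cong (eqb a (attach (φ b)) ∧_) (Lift-avoiding.edgeOn-c {Z} c∉ (φ b))) (∧-zeroʳ _)))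

    lift-edgeOn-CC : ∀ {a b} → a ∈ Q → b ∈ Q → edgeOn a b (lift Z alt) ≡ maybe′ (inSegment a b) false (other Z alt)
    lift-edgeOn-CC {a} {b} a∈ b∈ with c ∈?ᴴ verts Z
    ... | yes c∈ = Lift-through.edgeOn-CC (through Z alt c∈) {a} {b} a∈ b∈
    ... | no c∉  = Lift-avoiding.edgeOn-C {Z} c∉ b a∈

    other-edgeOn : ∀ y → y ≢ p → y ≢ c → justᵇ y (other Z alt) ≡ edgeOn c y Z
    other-edgeOn y y≢p y≢c with c ∈?ᴴ verts Z
    ... | yes c∈ = sym (trans (Lift-through.edgeOn-c (through Z alt c∈) y y≢c)
                     (cong (_∨ eqb (Lift-through.y (through Z alt c∈)) y) (eqb-false (y≢p ∘ sym))))
    ... | no c∉  = sym (Lift-avoiding.edgeOn-c {Z} c∉ y)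

    other≢p : justᵇ p (other Z alt) ≡ false
    other≢p with c ∈?ᴴ verts Z
    ... | yes c∈ = eqb-false (Lift-through.p≢y (through Z alt c∈) ∘ sym)
    ... | no _   = refl

    other-Edge : ∀ y → justᵇ y (other Z alt) ≡ true → Edge H c y
    other-Edge y t with c ∈?ᴴ verts Z
    ... | yes c∈ = subst (Edge H c) (eqb-sound t) (Lift-through.Edge-cy (through Z alt c∈))
    other-Edge y () | no _

  multiplicity-sym : ∀ (L : List (Cycle G)) a b → multiplicity a b L ≡ multiplicity b a L
  multiplicity-sym L a b = countᵇ-cong L (λ Z → cong (0 <ᵇ_) (countᵇ-cong (cycEdges (verts Z)) (sameEdge-sym a b)))

  module _ {𝒜 : List (Cycle H)} (alts : All (FAlternating F′) 𝒜)
           (zero-sum : ∀ u v → Edge H u v → Even (multiplicity u v 𝒜)) where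

    lifts : List (Cycle G)
    lifts = All.reduce (λ {Z} alt → lift Z alt) alts

    others : List (Maybe (V H))
    others = All.reduce (λ {Z} alt → other Z alt) alts

    absent⇒even : ∀ y → (∀ Z (alt : FAlternating F′ Z) → justᵇ y (other Z alt) ≡ false) → 2 ∣ countᵇ (justᵇ y) others
    absent⇒even y never = subst (2 ∣_) (sym (trans (countᵇ-reduce (justᵇ y) (λ {Z} alt → other Z alt) (λ _ → false)
      (λ {Z} alt → never Z alt) alts) (countᵇ-none {xs = 𝒜} (All.tabulate (λ _ → refl))))) (2 ∣0)

    even-others : ∀ y → 2 ∣ countᵇ (justᵇ y) others
    even-others y with y ≟F p | adj H c y in cy
    ... | yes refl | _     = absent⇒even p (λ Z alt → other≢p Z alt)
    ... | no y≢p   | true  = subst (2 ∣_) (sym (countᵇ-reduce (justᵇ y) (λ {Z} alt → other Z alt) (edgeOn c y)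
                               (λ {Z} alt → other-edgeOn Z alt y y≢p (Edge-c⇒≢c cy)) alts)) (zero-sum c y cy)
    ... | no _     | false = absent⇒even y never
      where
      never : ∀ Z (alt : FAlternating F′ Z) → justᵇ y (other Z alt) ≡ false
      never Z alt with justᵇ y (other Z alt) in t
      ... | false = refl
      ... | true with trans (sym (other-Edge Z alt y t)) cy
      ...   | ()

    zero-sum-CO : ∀ a b → Edge G a b → a ∈ Q → b ∉ Q → Even (multiplicity a b lifts)
    zero-sum-CO a b ab a∈ b∉ = subst (2 ∣_) (sym (trans
        (countᵇ-reduce _ _ (λ Z → eqb a (attach (φ b)) ∧ edgeOn c (φ b) Z) (λ {Z} alt → lift-edgeOn-CO Z alt a∈ b∉) alts)
        (countᵇ-∧ (eqb a (attach (φ b))) (edgeOn c (φ b)) 𝒜)))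
      (if-even (eqb a (attach (φ b))))
      where
      if-even : ∀ β → 2 ∣ (if β then multiplicity c (φ b) 𝒜 else 0)
      if-even true  = zero-sum c (φ b) (Edge-φ-C (∈Q⇒∈C a∈) (∉Q⇒∉C b∉) ab)
      if-even false = 2 ∣0

    lifts-zero-sum : ∀ a b → Edge G a b → Even (multiplicity a b lifts)
    lifts-zero-sum a b ab = by-membership a
      (λ a∈ → by-membership b
        (λ b∈ → subst (2 ∣_) (sym (countᵇ-reduce₂ _ _ (maybe′ (inSegment a b) false) _
                   (λ {Z} alt → lift-edgeOn-CC Z alt a∈ b∈) alts))
                 (countᵇ-maybe-even (inSegment a b) others even-others))
        (λ b∉ → zero-sum-CO a b ab a∈ b∉))
      (λ a∉ → by-membership b
        (λ b∈ → subst (2 ∣_) (multiplicity-sym lifts b a) (zero-sum-CO b a (Edge-sym G ab) b∈ a∉))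
        (λ b∉ → subst (2 ∣_) (sym (countᵇ-reduce _ _ (edgeOn (φ a) (φ b)) (λ {Z} alt → lift-edgeOn-OO Z alt a∉ b∉) alts))
                 (zero-sum (φ a) (φ b) (Edge-φ (∉Q⇒∉C a∉) (∉Q⇒∉C b∉) ab))))

  simplyBad : (𝒜 : List (Cycle H)) → OddFSet F′ 𝒜 → All (EvenlyOriented D′) 𝒜 → SimplyBad G
  simplyBad 𝒜 ((alts , zero-sum) , odd) evens =
    F , lifts alts zero-sum ,
    ((All-reduce _ (λ {Z} alt _ → lift-alternating Z alt) alts alts , lifts-zero-sum alts zero-sum) ,
     subst Odd (sym (length-reduce _ alts)) odd) ,
    D , All-reduce _ (λ {Z} alt → lift-evenly Z alt) alts evens

simplyBad-uncontract : ∀ {G H} → SimplyReducible G H → SimplyBad H → SimplyBad G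
simplyBad-uncontract {G} {H} (C , C-odd , φ , c , φ-C , φ-out , φ-injective , φ-onto , adj⇔) (F′ , 𝒜 , odd-set , D′ , evens) =
  Uncontract.simplyBad G H C C-odd φ c φ-C φ-out φ-injective φ-onto adj⇔ F′ D′ 𝒜 odd-set evens

lemma3p9 : (G H : Graph) → Reducible G H → SimplyBad H → SimplyBad G
lemma3p9 G .G ε        bad = bad
lemma3p9 G H  (r ◅ rs) bad = simplyBad-uncontract r (lemma3p9 _ H rs bad)
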